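{- Let $D=(V,A)$ be a digraph and let $q$ be a positive integer. Then $$\chi^{\geq}_D(-q)=(-1)^{|V(\mathrm{acyc}(D))|}\,\chi^{>}_{\mathrm{acyc}(D)}(q),$$ where $\mathrm{acyc}(D)$ is the (acyclic) digraph obtained from $D$ by contracting all its cyclic arcs and $|V(\mathrm{acyc}(D))|$ is its number of vertices.
   Context: Digraphs are finite, loops and multiple arcs allowed. An arc is cyclic if it lies on a directed cycle. The strict-chromatic polynomial $\chi^{>}_D(q)$ is the polynomial whose value at each positive integer $q$ is the number of $f:V\to\{1,\dots,q\}$ with $f(u)<f(v)$ for all $(u,v)\in A$; the weak-chromatic polynomial $\chi^{\geq}_D(q)$ counts those with $f(u)\le f(v)$ for all $(u,v)\in A$. Contracting an arc means removing it and identifying its endpoints. -}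

module Defs where

open import Data.Nat using (ℕ; zero; suc)
open import Data.Fin using (Fin; toℕ)
import Data.Fin as F
open import Data.Integer as ℤ using (ℤ; +_; -_)
open import Data.List using (List; []; _∷_; [_]; map; concatMap; filter; length; foldr)
open import Data.List.Membership.Propositional using (_∈_)
open import Data.List.Relation.Unary.All using (All; all?)
open import Data.Vec using (Vec; lookup) renaming ([] to []ᵥ; _∷_ to _∷ᵥ_)
open import Data.Product using (_×_; _,_; Σ; ∃)
open import Data.Fin.Base using (_≤_; _<_)
open import Data.Fin.Properties using (_≤?_; _<?_)
open import Relation.Nullary using (¬_)
open import Relation.Binary.PropositionalEquality using (_≡_)
open import Relation.Binary.Construct.Closure.ReflexiveTransitive using (Star)
open import Relation.Binary.Construct.Closure.Equivalence using (EqClosure)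
open import Function.Bundles using (_⇔_)

-- A digraph on vertex set Fin n: a finite list of arcs (u , v).
-- Loops and repeated arcs (multiple arcs) are allowed.
record Digraph : Set where
  constructor digraph
  field
    nV   : ℕ
    arcs : List (Fin nV × Fin nV)
open Digraph public

-- All maps V → {1..q}, encoded as vectors over Fin q (value i ↦ i+1).
allMaps : (n q : ℕ) → List (Vec (Fin q) n)
allMaps zero    q = [ []ᵥ ]
allMaps (suc n) q = concatMap (λ v → map (_∷ᵥ v) (Data.List.allFin q)) (allMaps n q)
  where import Data.List

StrictOK : ∀ {n q} → List (Fin n × Fin n) → Vec (Fin q) n → Set
StrictOK A f = All (λ { (u , v) → lookup f u < lookup f v }) A

WeakOK : ∀ {n q} → List (Fin n × Fin n) → Vec (Fin q) n → Set
WeakOK A f = All (λ { (u , v) → lookup f u ≤ lookup f v }) A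

-- Number of strict / weak colorings with q colors (the values of the
-- strict- and weak-chromatic polynomials at the positive integer q).
strictCount : Digraph → ℕ → ℕ
strictCount D q =
  length (filter (λ f → all? (λ { (u , v) → lookup f u <? lookup f v }) (arcs D)) (allMaps (nV D) q))

weakCount : Digraph → ℕ → ℕ
weakCount D q =
  length (filter (λ f → all? (λ { (u , v) → lookup f u ≤? lookup f v }) (arcs D)) (allMaps (nV D) q))

-- Integer polynomials as coefficient lists (constant term first).
Poly : Set
Poly = List ℤ

eval : Poly → ℤ → ℤ
eval p x = foldr (λ a acc → a ℤ.+ x ℤ.* acc) (+ 0) p

IsWeakChromPoly : Digraph → Poly → Set
IsWeakChromPoly D P = ∀ q → eval P (+ suc q) ≡ + weakCount D (suc q)

Arc : (D : Digraph) → Fin (nV D) → Fin (nV D) → Set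
Arc D u v = (u , v) ∈ arcs D

Reach : (D : Digraph) → Fin (nV D) → Fin (nV D) → Set
Reach D = Star (Arc D)

-- An arc (u , v) is cyclic iff it lies on a directed cycle, i.e. there is a
-- directed walk from v back to u.
Cyclic : (D : Digraph) → Fin (nV D) × Fin (nV D) → Set
Cyclic D (u , v) = Reach D v u

CycArc : (D : Digraph) → Fin (nV D) → Fin (nV D) → Set
CycArc D u v = (u , v) ∈ arcs D × Cyclic D (u , v)

data ContractArcs {n m : ℕ} (cyc : Fin n × Fin n → Set) (c : Fin n → Fin m)
     : List (Fin n × Fin n) → List (Fin m × Fin m) → Set where
  done : ContractArcs cyc c [] []
  drop : ∀ {a as bs} → cyc a → ContractArcs cyc c as bs → ContractArcs cyc c (a ∷ as) bs
  keep : ∀ {u v as bs} → ¬ cyc (u , v) → ContractArcs cyc c as bs →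
         ContractArcs cyc c ((u , v) ∷ as) ((c u , c v) ∷ bs)

-- D' (together with the quotient map c) is acyc(D): the digraph obtained from
-- D by contracting all cyclic arcs.
record IsAcyc (D D' : Digraph) : Set where
  field
    c        : Fin (nV D) → Fin (nV D')
    c-surj   : ∀ j → ∃ λ i → c i ≡ j
    c-ident  : ∀ u v → (c u ≡ c v) ⇔ EqClosure (CycArc D) u v
    c-arcs   : ContractArcs (Cyclic D) c (arcs D) (arcs D')

-- A weak colouring is constant on each class of vertices joined by cyclic arcs, so D and acyc(D) have
-- the same weak colourings, and it suffices to treat an acyclic digraph. For a set U of vertices let W_U(q)
-- and S_U(q) count the weak and the strict colourings of the subdigraph induced on U with q colours.
-- Splitting off the vertices of the lowest colour gives W_U(q+1) = Σ_{T ⊆ U} W_T(q) when U is closed under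
-- out-arcs. For strict colourings the lowest colour class consists of sinks, and as every nonempty vertex
-- set of an acyclic digraph has a sink, inclusion–exclusion over that class gives
-- Σ_{T ⊆ U} (-1)^|T| S_T(q+1) = (-1)^|U| S_U(q). So the function that is W_U(q) at q ≥ 0 and
-- (-1)^|U| S_U(-q) at q < 0 obeys one recursion on all of ℤ, which makes it a polynomial. For U = V it
-- agrees with the weak-chromatic polynomial at the positive integers, hence everywhere.

module Submission where

open import Defs
open import Data.Nat using (ℕ; suc)
open import Data.Integer using (ℤ; +_; -_; _*_; _^_)
open import Relation.Binary.PropositionalEquality using (_≡_)

open import Data.Bool as Bool using (Bool; true; false; not; _∨_; if_then_else_)
import Data.Bool.Properties as Bool
open import Data.Empty using (⊥)
open import Data.Fin as Fin using (Fin; zero; suc; toℕ; _≤_; _<_)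
import Data.Fin.Properties as Fin
open import Data.Fin.Subset
  using (Subset; inside; outside; _∈_; _∉_; _⊆_; _⊂_; ∁; _∪_; _─_; ∣_∣; ⊤) renaming (⊥ to ∅)
open import Data.Fin.Subset.Properties
  using ( _∈?_; _⊆?_; _⊂?_; ⊆-refl; ⊆-antisym; ⊂-irref; drop-∷-⊆; out⊂in; s⊂s; p⊂q⇒p⊆q; p⊂q⇒∣p∣<∣q∣
        ; p⊆p∪q; q⊆p∪q; x∈p∪q⁻; x∈p∪q⁺; p─q⊆p; x∈p∧x∉q⇒x∈p─q; x∈∁p⇒x∉p; x∉p⇒x∈∁p
        ; ∉⊥; ∣⊥∣≡0; ∣⊤∣≡n; Empty-unique )
open import Data.Integer as ℤ using (-[1+_]; 0ℤ; 1ℤ; -1ℤ; _+_; _-_)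
open import Data.Integer.Properties
  using ( +-identityˡ; +-identityʳ; +-assoc; +-inverseʳ; *-zeroˡ; *-zeroʳ; *-identityˡ; *-identityʳ
        ; *-comm; *-assoc; *-distribˡ-+; *-distribʳ-+; ^-distribˡ-+-*; i-j≡0⇒i≡j )
open import Data.Integer.Tactic.RingSolver using (solve-∀)
open import Data.List as List using (List; []; _∷_; [_]; _++_; map; concatMap; filter; length; allFin)
import Data.List.Properties as List
open import Data.List.Membership.Propositional using (find; lose) renaming (_∈_ to _∈ₗ_)
open import Data.List.Relation.Unary.All as All using (All; all?; []; _∷_)
open import Data.List.Relation.Unary.Any as Any using (Any; any?)
open import Data.Nat as ℕ using (zero; z≤n; s≤s)
import Data.Nat.Properties as ℕ
open import Data.Product using (_×_; _,_; proj₁; proj₂; ∃; ∃₂)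
open import Data.Sum using (_⊎_; inj₁; inj₂)
open import Data.Unit as Unit using (tt)
open import Data.Vec as Vec using (Vec; lookup; tabulate; here; there) renaming ([] to []ᵥ; _∷_ to _∷ᵥ_)
import Data.Vec.Properties as Vec
open import Function using (_∘_; _⇔_; mk⇔; Equivalence)
open import Relation.Binary using (DecidableEquality)
open import Relation.Binary.Construct.Closure.ReflexiveTransitive using (ε; _◅_; _◅◅_)
open import Relation.Binary.Construct.Closure.Symmetric using (fwd; bwd)
open import Relation.Binary.Construct.Closure.Equivalence using (EqClosure)
open import Relation.Binary.PropositionalEquality using (_≢_; refl; sym; trans; cong; cong₂; subst; subst₂; module ≡-Reasoning)
open import Relation.Nullary using (Dec; yes; no; does; ¬_; contradiction)
open import Relation.Nullary.Decidable using (_×-dec_; _→-dec_; ¬?; dec-true; does-⇔; decidable-stable)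
open import Relation.Unary using (Pred; Decidable)

open Equivalence

module _ {a} {A : Set a} where

  ∑ : List A → (A → ℤ) → ℤ
  ∑ []       φ = 0ℤ
  ∑ (x ∷ xs) φ = φ x + ∑ xs φ

  syntax ∑ xs (λ x → e) = ∑[ x ∈ xs ] e

  ∑-cong : ∀ xs {φ ψ : A → ℤ} → (∀ x → φ x ≡ ψ x) → ∑ xs φ ≡ ∑ xs ψ
  ∑-cong []       eq = refl
  ∑-cong (x ∷ xs) eq = cong₂ _+_ (eq x) (∑-cong xs eq)

  ∑-zero : ∀ xs {φ : A → ℤ} → (∀ x → φ x ≡ 0ℤ) → ∑ xs φ ≡ 0ℤ
  ∑-zero []       eq = refl
  ∑-zero (x ∷ xs) eq = cong₂ _+_ (eq x) (∑-zero xs eq)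

  ∑-distrib-+ : ∀ xs (φ ψ : A → ℤ) → ∑[ x ∈ xs ] (φ x + ψ x) ≡ ∑ xs φ + ∑ xs ψ
  ∑-distrib-+ []       φ ψ = refl
  ∑-distrib-+ (x ∷ xs) φ ψ = trans (cong (_+_ (φ x + ψ x)) (∑-distrib-+ xs φ ψ))
                                   (interchange (φ x) (ψ x) (∑ xs φ) (∑ xs ψ))
    where
    interchange : ∀ a b c d → (a + b) + (c + d) ≡ (a + c) + (b + d)
    interchange = solve-∀

  ∑-*ˡ : ∀ xs c (φ : A → ℤ) → ∑[ x ∈ xs ] (c * φ x) ≡ c * ∑ xs φ
  ∑-*ˡ []       c φ = sym (*-zeroʳ c)
  ∑-*ˡ (x ∷ xs) c φ = trans (cong (_+_ (c * φ x)) (∑-*ˡ xs c φ)) (sym (*-distribˡ-+ c (φ x) (∑ xs φ)))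

  ∑-*ʳ : ∀ xs c (φ : A → ℤ) → ∑[ x ∈ xs ] (φ x * c) ≡ ∑ xs φ * c
  ∑-*ʳ xs c φ = trans (∑-cong xs (λ x → *-comm (φ x) c)) (trans (∑-*ˡ xs c φ) (*-comm c (∑ xs φ)))

  ∑-++ : ∀ xs ys (φ : A → ℤ) → ∑ (xs ++ ys) φ ≡ ∑ xs φ + ∑ ys φ
  ∑-++ []       ys φ = sym (+-identityˡ (∑ ys φ))
  ∑-++ (x ∷ xs) ys φ = trans (cong (_+_ (φ x)) (∑-++ xs ys φ)) (sym (+-assoc (φ x) (∑ xs φ) (∑ ys φ)))

module _ {a b} {A : Set a} {B : Set b} where

  ∑-map : ∀ (f : A → B) xs (φ : B → ℤ) → ∑ (map f xs) φ ≡ ∑[ x ∈ xs ] φ (f x)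
  ∑-map f []       φ = refl
  ∑-map f (x ∷ xs) φ = cong (_+_ (φ (f x))) (∑-map f xs φ)

  ∑-concatMap : ∀ (f : A → List B) xs (φ : B → ℤ) → ∑ (concatMap f xs) φ ≡ ∑[ x ∈ xs ] ∑ (f x) φ
  ∑-concatMap f []       φ = refl
  ∑-concatMap f (x ∷ xs) φ =
    trans (∑-++ (f x) (concatMap f xs) φ) (cong (_+_ (∑ (f x) φ)) (∑-concatMap f xs φ))

  ∑-comm : ∀ xs ys (φ : A → B → ℤ) → ∑[ x ∈ xs ] ∑[ y ∈ ys ] φ x y ≡ ∑[ y ∈ ys ] ∑[ x ∈ xs ] φ x y
  ∑-comm []       ys φ = sym (∑-zero ys (λ _ → refl))
  ∑-comm (x ∷ xs) ys φ =
    trans (cong (_+_ (∑ ys (φ x))) (∑-comm xs ys φ)) (sym (∑-distrib-+ ys (φ x) (λ y → ∑[ x ∈ xs ] φ x y)))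

𝟙 : ∀ {p} {P : Set p} → Dec P → ℤ
𝟙 d = if does d then 1ℤ else 0ℤ

module _ {p q} {P : Set p} {Q : Set q} where

  𝟙-cong : (d : Dec P) (e : Dec Q) → P ⇔ Q → 𝟙 d ≡ 𝟙 e
  𝟙-cong d e P⇔Q = cong (if_then 1ℤ else 0ℤ) (does-⇔ P⇔Q d e)

  𝟙-*-cong : (d : Dec P) (e : Dec Q) {x y : ℤ} → P ⇔ Q → (P → x ≡ y) → 𝟙 d * x ≡ 𝟙 e * y
  𝟙-*-cong (yes p) (yes _) p⇔q x≡y = cong (_*_ 1ℤ) (x≡y p)
  𝟙-*-cong (no _)  (no _)  _   _   = refl
  𝟙-*-cong (yes p) (no ¬q) p⇔q x≡y = contradiction (to p⇔q p) ¬q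
  𝟙-*-cong (no ¬p) (yes q) p⇔q x≡y = contradiction (from p⇔q q) ¬p

  𝟙-× : (d : Dec P) (e : Dec Q) → 𝟙 (d ×-dec e) ≡ 𝟙 d * 𝟙 e
  𝟙-× (yes _) (yes _) = refl
  𝟙-× (yes _) (no _)  = refl
  𝟙-× (no _)  _       = refl

𝟙-yes : ∀ {p} {P : Set p} (d : Dec P) → P → 𝟙 d ≡ 1ℤ
𝟙-yes (yes _) _ = refl
𝟙-yes (no ¬p) p = contradiction p ¬p

𝟙-no : ∀ {p} {P : Set p} (d : Dec P) → ¬ P → 𝟙 d ≡ 0ℤ
𝟙-no (yes p) ¬p = contradiction p ¬p
𝟙-no (no _)  _  = refl

𝟙-×³ : ∀ {p q r} {P : Set p} {Q : Set q} {R : Set r} (d : Dec P) (e : Dec Q) (f : Dec R) →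
       𝟙 d * (𝟙 e * 𝟙 f) ≡ 𝟙 (d ×-dec e ×-dec f)
𝟙-×³ d e f = sym (trans (𝟙-× d (e ×-dec f)) (cong (𝟙 d *_) (𝟙-× e f)))

length-filter : ∀ {a p} {A : Set a} {P : Pred A p} (P? : Decidable P) xs →
                + length (filter P? xs) ≡ ∑[ x ∈ xs ] 𝟙 (P? x)
length-filter P? []       = refl
length-filter P? (x ∷ xs) with P? x
... | yes _ = cong (_+_ 1ℤ) (length-filter P? xs)
... | no  _ = trans (length-filter P? xs) (sym (+-identityˡ _))

All-⇔× : ∀ {a p q r} {A : Set a} {P : A → Set p} {Q : A → Set q} {R : A → Set r} →
         (∀ x → P x ⇔ (Q x × R x)) → ∀ xs → All P xs ⇔ (All Q xs × All R xs)
All-⇔× P⇔Q×R xs = mk⇔ (All.unzipWith (to (P⇔Q×R _))) (All.zipWith (from (P⇔Q×R _)))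

record Sifting {a} {A : Set a} (_≟_ : DecidableEquality A) (xs : List A) : Set a where
  field
    sift : ∀ x₀ (χ : A → ℤ) → ∑[ x ∈ xs ] (𝟙 (x ≟ x₀) * χ x) ≡ χ x₀
open Sifting public

module _ {a} {A : Set a} where

  vectors : List A → (n : ℕ) → List (Vec A n)
  vectors xs zero    = [ []ᵥ ]
  vectors xs (suc n) = concatMap (λ v → map (_∷ᵥ v) xs) (vectors xs n)

  ∑-vectors-zero : ∀ xs (φ : Vec A 0 → ℤ) → ∑ (vectors xs 0) φ ≡ φ []ᵥ
  ∑-vectors-zero xs φ = +-identityʳ (φ []ᵥ)

  ∑-vectors-suc : ∀ xs n (φ : Vec A (suc n) → ℤ) →
                  ∑ (vectors xs (suc n)) φ ≡ ∑[ v ∈ vectors xs n ] ∑[ x ∈ xs ] φ (x ∷ᵥ v)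
  ∑-vectors-suc xs n φ =
    trans (∑-concatMap _ (vectors xs n) φ) (∑-cong (vectors xs n) (λ v → ∑-map (_∷ᵥ v) xs φ))

  vectors-sifting : ∀ {_≟_ xs} → Sifting _≟_ xs → ∀ n → Sifting (Vec.≡-dec _≟_) (vectors xs n)
  vectors-sifting {_≟_} {xs} s n = record { sift = go n }
    where
    _≟ⁿ_ : ∀ {k} → DecidableEquality (Vec A k)
    _≟ⁿ_ = Vec.≡-dec _≟_
    go : ∀ n w (χ : Vec A n → ℤ) → ∑[ v ∈ vectors xs n ] (𝟙 (v ≟ⁿ w) * χ v) ≡ χ w
    go zero    []ᵥ      χ = trans (∑-vectors-zero xs (λ v → 𝟙 (v ≟ⁿ []ᵥ) * χ v)) (*-identityˡ (χ []ᵥ))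
    go (suc n) (a ∷ᵥ w) χ = begin
      ∑[ v ∈ vectors xs (suc n) ] (𝟙 (v ≟ⁿ (a ∷ᵥ w)) * χ v)
        ≡⟨ ∑-vectors-suc xs n (λ v → 𝟙 (v ≟ⁿ (a ∷ᵥ w)) * χ v) ⟩
      ∑[ v ∈ vectors xs n ] ∑[ x ∈ xs ] (𝟙 ((x ∷ᵥ v) ≟ⁿ (a ∷ᵥ w)) * χ (x ∷ᵥ v))
        ≡⟨ ∑-cong (vectors xs n) (λ v → ∑-cong xs (λ x → split x v)) ⟩
      ∑[ v ∈ vectors xs n ] ∑[ x ∈ xs ] (𝟙 (x ≟ a) * (𝟙 (v ≟ⁿ w) * χ (x ∷ᵥ v)))
        ≡⟨ ∑-cong (vectors xs n) (λ v → sift s a (λ x → 𝟙 (v ≟ⁿ w) * χ (x ∷ᵥ v))) ⟩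
      ∑[ v ∈ vectors xs n ] (𝟙 (v ≟ⁿ w) * χ (a ∷ᵥ v))
        ≡⟨ go n w (λ v → χ (a ∷ᵥ v)) ⟩
      χ (a ∷ᵥ w) ∎
      where
      open ≡-Reasoning
      split : ∀ x v → 𝟙 ((x ∷ᵥ v) ≟ⁿ (a ∷ᵥ w)) * χ (x ∷ᵥ v)
                    ≡ 𝟙 (x ≟ a) * (𝟙 (v ≟ⁿ w) * χ (x ∷ᵥ v))
      split x v = begin
        𝟙 ((x ∷ᵥ v) ≟ⁿ (a ∷ᵥ w)) * χ (x ∷ᵥ v)
          ≡⟨ cong (_* χ (x ∷ᵥ v)) (𝟙-cong ((x ∷ᵥ v) ≟ⁿ (a ∷ᵥ w)) ((x ≟ a) ×-dec (v ≟ⁿ w))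
               (mk⇔ Vec.∷-injective (λ (x≡a , v≡w) → cong₂ _∷ᵥ_ x≡a v≡w))) ⟩
        𝟙 ((x ≟ a) ×-dec (v ≟ⁿ w)) * χ (x ∷ᵥ v)
          ≡⟨ cong (_* χ (x ∷ᵥ v)) (𝟙-× (x ≟ a) (v ≟ⁿ w)) ⟩
        𝟙 (x ≟ a) * 𝟙 (v ≟ⁿ w) * χ (x ∷ᵥ v)
          ≡⟨ *-assoc (𝟙 (x ≟ a)) (𝟙 (v ≟ⁿ w)) (χ (x ∷ᵥ v)) ⟩
        𝟙 (x ≟ a) * (𝟙 (v ≟ⁿ w) * χ (x ∷ᵥ v)) ∎

≗⇒≡ : ∀ {a n} {A : Set a} {u v : Vec A n} → (∀ i → lookup u i ≡ lookup v i) → u ≡ v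
≗⇒≡ {u = u} {v} u≗v = trans (sym (Vec.tabulate∘lookup u)) (trans (Vec.tabulate-cong u≗v) (Vec.tabulate∘lookup v))

∑-allFin-suc : ∀ q (φ : Fin (suc q) → ℤ) → ∑ (allFin (suc q)) φ ≡ φ zero + ∑[ i ∈ allFin q ] φ (suc i)
∑-allFin-suc q φ = cong (_+_ (φ zero))
  (trans (cong (λ is → ∑ is φ) (sym (List.map-tabulate (λ i → i) suc))) (∑-map suc (allFin q) φ))

allFin-sifting : ∀ q → Sifting Fin._≟_ (allFin q)
allFin-sifting q = record { sift = go q }
  where
  go : ∀ q a (χ : Fin q → ℤ) → ∑[ x ∈ allFin q ] (𝟙 (x Fin.≟ a) * χ x) ≡ χ a
  go (suc q) zero χ = begin
    ∑[ x ∈ allFin (suc q) ] (𝟙 (x Fin.≟ zero) * χ x)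
      ≡⟨ ∑-allFin-suc q (λ x → 𝟙 (x Fin.≟ zero) * χ x) ⟩
    1ℤ * χ zero + ∑[ x ∈ allFin q ] (0ℤ * χ (suc x))
      ≡⟨ cong₂ _+_ (*-identityˡ (χ zero)) (∑-zero (allFin q) (λ x → *-zeroˡ (χ (suc x)))) ⟩
    χ zero + 0ℤ
      ≡⟨ +-identityʳ (χ zero) ⟩
    χ zero ∎
    where open ≡-Reasoning
  go (suc q) (suc a) χ = begin
    ∑[ x ∈ allFin (suc q) ] (𝟙 (x Fin.≟ suc a) * χ x)
      ≡⟨ ∑-allFin-suc q (λ x → 𝟙 (x Fin.≟ suc a) * χ x) ⟩
    0ℤ * χ zero + ∑[ x ∈ allFin q ] (𝟙 (suc x Fin.≟ suc a) * χ (suc x))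
      ≡⟨ +-identityˡ _ ⟩
    ∑[ x ∈ allFin q ] (𝟙 (suc x Fin.≟ suc a) * χ (suc x))
      ≡⟨ ∑-cong (allFin q) (λ x → cong (_* χ (suc x))
           (𝟙-cong (suc x Fin.≟ suc a) (x Fin.≟ a) (mk⇔ Fin.suc-injective (cong suc)))) ⟩
    ∑[ x ∈ allFin q ] (𝟙 (x Fin.≟ a) * χ (suc x))
      ≡⟨ go q a (χ ∘ suc) ⟩
    χ (suc a) ∎
    where open ≡-Reasoning

allMaps≡vectors : ∀ n q → allMaps n q ≡ vectors (allFin q) n
allMaps≡vectors zero    q = refl
allMaps≡vectors (suc n) q = cong (concatMap (λ v → map (_∷ᵥ v) (allFin q))) (allMaps≡vectors n q)

∑-vectors-singleton : ∀ {a} {A : Set a} (x : A) n (φ : Vec A n → ℤ) → ∑ (vectors [ x ] n) φ ≡ φ (Vec.replicate n x)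
∑-vectors-singleton x zero    φ = ∑-vectors-zero [ x ] φ
∑-vectors-singleton x (suc n) φ =
  trans (∑-vectors-suc [ x ] n φ) (trans (∑-cong (vectors [ x ] n) (λ v → +-identityʳ (φ (x ∷ᵥ v))))
        (∑-vectors-singleton x n (λ v → φ (x ∷ᵥ v))))

∑-𝟙-transport : ∀ {a b p q} {X : Set a} {Y : Set b} {P : X → Set p} {Q : Y → Set q}
  {_≟X_ : DecidableEquality X} {_≟Y_ : DecidableEquality Y} xs ys →
  Sifting _≟X_ xs → Sifting _≟Y_ ys → (P? : ∀ x → Dec (P x)) (Q? : ∀ y → Dec (Q y)) (h : Y → X) →
  (∀ {y y′} → Q y → Q y′ → h y ≡ h y′ → y ≡ y′) → (∀ {y} → Q y → P (h y)) →
  (∀ {x} → P x → ∃ λ y → Q y × h y ≡ x) →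
  ∑[ x ∈ xs ] 𝟙 (P? x) ≡ ∑[ y ∈ ys ] 𝟙 (Q? y)
∑-𝟙-transport {P = P} {_≟X_ = _≟X_} {_≟Y_} xs ys sift-xs sift-ys P? Q? h injective preserves onto = begin
  ∑[ x ∈ xs ] 𝟙 (P? x)
    ≡⟨ ∑-cong xs (λ x → sym (fibre x)) ⟩
  ∑[ x ∈ xs ] ∑[ y ∈ ys ] (𝟙 (x ≟X h y) * 𝟙 (Q? y))
    ≡⟨ ∑-comm xs ys (λ x y → 𝟙 (x ≟X h y) * 𝟙 (Q? y)) ⟩
  ∑[ y ∈ ys ] ∑[ x ∈ xs ] (𝟙 (x ≟X h y) * 𝟙 (Q? y))
    ≡⟨ ∑-cong ys (λ y → sift sift-xs (h y) (λ _ → 𝟙 (Q? y))) ⟩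
  ∑[ y ∈ ys ] 𝟙 (Q? y) ∎
  where
  open ≡-Reasoning
  fibre : ∀ x → ∑[ y ∈ ys ] (𝟙 (x ≟X h y) * 𝟙 (Q? y)) ≡ 𝟙 (P? x)
  fibre x with P? x
  ... | no ¬Px = ∑-zero ys λ y → trans (sym (𝟙-× (x ≟X h y) (Q? y)))
    (𝟙-no (x ≟X h y ×-dec Q? y) (λ (x≡hy , Qy) → ¬Px (subst P (sym x≡hy) (preserves Qy))))
  ... | yes Px with onto Px
  ...   | y₀ , Qy₀ , hy₀≡x = trans (∑-cong ys pick) (sift sift-ys y₀ (λ _ → 1ℤ))
    where
    pick : ∀ y → 𝟙 (x ≟X h y) * 𝟙 (Q? y) ≡ 𝟙 (y ≟Y y₀) * 1ℤ
    pick y = trans (sym (𝟙-× (x ≟X h y) (Q? y))) (trans (𝟙-cong (x ≟X h y ×-dec Q? y) (y ≟Y y₀) (mk⇔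
      (λ (x≡hy , Qy) → injective Qy Qy₀ (trans (sym x≡hy) (sym hy₀≡x)))
      (λ { refl → sym hy₀≡x , Qy₀ }))) (sym (*-identityʳ _)))

-- Polynomial functions

Δ : (ℤ → ℤ) → ℤ → ℤ
Δ f x = f (ℤ.suc x) - f x

-- f is a polynomial function of degree < d: its d-th finite difference vanishes.
data Poly< : ℕ → (ℤ → ℤ) → Set where
  vanishing  : ∀ {f} → (∀ x → f x ≡ 0ℤ) → Poly< 0 f
  difference : ∀ {d f} → Poly< d (Δ f) → Poly< (suc d) f

Poly<-cong : ∀ {d f g} → (∀ x → f x ≡ g x) → Poly< d f → Poly< d g
Poly<-cong f≗g (vanishing f≗0) = vanishing (λ x → trans (sym (f≗g x)) (f≗0 x))
Poly<-cong f≗g (difference p)  = difference (Poly<-cong (λ x → cong₂ _-_ (f≗g (ℤ.suc x)) (f≗g x)) p)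

Poly<-zero : ∀ d {f} → (∀ x → f x ≡ 0ℤ) → Poly< d f
Poly<-zero zero    f≗0 = vanishing f≗0
Poly<-zero (suc d) f≗0 = difference (Poly<-zero d (λ x → cong₂ _-_ (f≗0 (ℤ.suc x)) (f≗0 x)))

Poly<-mono : ∀ {d e f} → d ℕ.≤ e → Poly< d f → Poly< e f
Poly<-mono {e = e} z≤n       (vanishing f≗0) = Poly<-zero e f≗0
Poly<-mono         (s≤s d≤e) (difference p)  = difference (Poly<-mono d≤e p)

Poly<-+ : ∀ {d f g} → Poly< d f → Poly< d g → Poly< d (λ x → f x + g x)
Poly<-+ (vanishing f≗0) (vanishing g≗0) = vanishing (λ x → cong₂ _+_ (f≗0 x) (g≗0 x))
Poly<-+ {f = f} {g} (difference p) (difference q) =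
  difference (Poly<-cong (λ x → interchange (f (ℤ.suc x)) (f x) (g (ℤ.suc x)) (g x)) (Poly<-+ p q))
  where
  interchange : ∀ a b c e → (a - b) + (c - e) ≡ (a + c) - (b + e)
  interchange = solve-∀

Poly<-sub : ∀ {d f g} → Poly< d f → Poly< d g → Poly< d (λ x → f x - g x)
Poly<-sub (vanishing f≗0) (vanishing g≗0) = vanishing (λ x → cong₂ _-_ (f≗0 x) (g≗0 x))
Poly<-sub {f = f} {g} (difference p) (difference q) =
  difference (Poly<-cong (λ x → interchange (f (ℤ.suc x)) (f x) (g (ℤ.suc x)) (g x)) (Poly<-sub p q))
  where
  interchange : ∀ a b c e → (a - b) - (c - e) ≡ (a - c) - (b - e)
  interchange = solve-∀

Poly<-*ˡ : ∀ {d f} c → Poly< d f → Poly< d (λ x → c * f x)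
Poly<-*ˡ c (vanishing f≗0) = vanishing (λ x → trans (cong (c *_) (f≗0 x)) (*-zeroʳ c))
Poly<-*ˡ {f = f} c (difference p) =
  difference (Poly<-cong (λ x → distrib c (f (ℤ.suc x)) (f x)) (Poly<-*ˡ c p))
  where
  distrib : ∀ c a b → c * (a - b) ≡ c * a - c * b
  distrib = solve-∀

Poly<-∘suc : ∀ {d f} → Poly< d f → Poly< d (λ x → f (ℤ.suc x))
Poly<-∘suc (vanishing f≗0) = vanishing (λ x → f≗0 (ℤ.suc x))
Poly<-∘suc (difference p)  = difference (Poly<-∘suc p)

Poly<-x* : ∀ {d f} → Poly< d f → Poly< (suc d) (λ x → x * f x)
Poly<-x* {f = f} (vanishing f≗0) =
  difference (vanishing (λ x → trans (cong₂ (λ a b → ℤ.suc x * a - x * b) (f≗0 (ℤ.suc x)) (f≗0 x))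
                                     (annihilate (ℤ.suc x) x)))
  where
  annihilate : ∀ a b → a * 0ℤ - b * 0ℤ ≡ 0ℤ
  annihilate = solve-∀
Poly<-x* {f = f} (difference p) =
  difference (Poly<-cong (λ x → product-rule x (f (ℤ.suc x)) (f x)) (Poly<-+ (Poly<-∘suc {f = f} (difference p)) (Poly<-x* p)))
  where
  product-rule : ∀ x a b → a + x * (a - b) ≡ (1ℤ + x) * a - x * b
  product-rule = solve-∀

Poly<-eval : ∀ P → Poly< (length P) (eval P)
Poly<-eval []      = vanishing (λ _ → refl)
Poly<-eval (a ∷ P) = Poly<-+ (Poly<-mono (s≤s z≤n) constant) (Poly<-x* (Poly<-eval P))
  where
  constant : Poly< 1 (λ _ → a)
  constant = difference (vanishing (λ _ → +-inverseʳ a))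

Poly<-∑ : ∀ {a} {A : Set a} d xs (φ : A → ℤ → ℤ) → (∀ y → Poly< d (φ y)) → Poly< d (λ x → ∑[ y ∈ xs ] φ y x)
Poly<-∑ d []       φ pφ = Poly<-zero d (λ _ → refl)
Poly<-∑ d (y ∷ xs) φ pφ = Poly<-+ (pφ y) (Poly<-∑ d xs φ pφ)

suc-invariant⇒constant : ∀ {f : ℤ → ℤ} → (∀ x → f (ℤ.suc x) ≡ f x) → ∀ x → f x ≡ f 0ℤ
suc-invariant⇒constant inv (+ zero)     = refl
suc-invariant⇒constant inv (+ suc m)    = trans (inv (+ m)) (suc-invariant⇒constant inv (+ m))
suc-invariant⇒constant inv -[1+ zero ]  = sym (inv -[1+ zero ])
suc-invariant⇒constant inv -[1+ suc m ] = trans (sym (inv -[1+ suc m ])) (suc-invariant⇒constant inv -[1+ m ])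

Poly<-vanishing : ∀ {d f} → Poly< d f → (∀ k → f (+ suc k) ≡ 0ℤ) → ∀ x → f x ≡ 0ℤ
Poly<-vanishing     (vanishing f≗0) _    = f≗0
Poly<-vanishing {f = f} (difference p) f+≡0 x =
  trans (suc-invariant⇒constant invariant x) (trans (sym (invariant 0ℤ)) (f+≡0 0))
  where
  invariant : ∀ y → f (ℤ.suc y) ≡ f y
  invariant y = i-j≡0⇒i≡j _ _ (Poly<-vanishing p (λ k → cong₂ _-_ (f+≡0 (suc k)) (f+≡0 k)) y)

Poly<-agree : ∀ {d e f g} → Poly< d f → Poly< e g → (∀ k → f (+ suc k) ≡ g (+ suc k)) → ∀ x → f x ≡ g x
Poly<-agree {d} {e} {f} {g} pf pg agree x = i-j≡0⇒i≡j (f x) (g x)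
  (Poly<-vanishing (Poly<-sub (Poly<-mono (ℕ.m≤m⊔n d e) pf) (Poly<-mono (ℕ.m≤n⊔m d e) pg))
                   (λ k → trans (cong (_- g (+ suc k)) (agree k)) (+-inverseʳ (g (+ suc k)))) x)

sides : List Bool
sides = inside ∷ outside ∷ []

subsets : ∀ n → List (Subset n)
subsets = vectors sides

∑-subsets-suc : ∀ n (φ : Subset (suc n) → ℤ) →
                ∑ (subsets (suc n)) φ ≡ ∑[ T ∈ subsets n ] (φ (inside ∷ᵥ T) + φ (outside ∷ᵥ T))
∑-subsets-suc n φ = trans (∑-vectors-suc _ n φ)
  (∑-cong (subsets n) (λ T → cong (_+_ (φ (inside ∷ᵥ T))) (+-identityʳ (φ (outside ∷ᵥ T)))))

_≟ˢ_ : ∀ {n} → DecidableEquality (Subset n)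
_≟ˢ_ = Vec.≡-dec Bool._≟_

subsets-sifting : ∀ n → Sifting _≟ˢ_ (subsets n)
subsets-sifting = vectors-sifting sides-sifting
  where
  sides-sifting : Sifting Bool._≟_ sides
  sides-sifting = record { sift = go }
    where
    go : ∀ a (χ : Bool → ℤ) → ∑[ x ∈ sides ] (𝟙 (x Bool.≟ a) * χ x) ≡ χ a
    go true  χ = pick-first (χ true) (χ false)
      where
      pick-first : ∀ a b → 1ℤ * a + (0ℤ * b + 0ℤ) ≡ a
      pick-first = solve-∀
    go false χ = pick-second (χ true) (χ false)
      where
      pick-second : ∀ a b → 0ℤ * a + (1ℤ * b + 0ℤ) ≡ b
      pick-second = solve-∀

sgn : ∀ {n} → Subset n → ℤ
sgn T = -1ℤ ^ ∣ T ∣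

∑-sgn-⊆ : ∀ {n} (K : Subset n) → ∑[ T ∈ subsets n ] (𝟙 (T ⊆? K) * sgn T) ≡ 𝟙 (K ≟ˢ ∅)
∑-sgn-⊆ []ᵥ = refl
∑-sgn-⊆ {suc n} (inside ∷ᵥ K) = trans (∑-subsets-suc n _) (∑-zero (subsets n) (λ T → cancel (𝟙 (T ⊆? K)) (sgn T)))
  where
  cancel : ∀ a s → a * (-1ℤ * s) + a * s ≡ 0ℤ
  cancel = solve-∀
∑-sgn-⊆ {suc n} (outside ∷ᵥ K) =
  trans (∑-subsets-suc n _) (trans (∑-cong (subsets n) (λ T → drop-first (sgn T) (𝟙 (T ⊆? K) * sgn T))) (∑-sgn-⊆ K))
  where
  drop-first : ∀ s b → 0ℤ * (-1ℤ * s) + b ≡ b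
  drop-first = solve-∀

𝟙-∷-⊆ : ∀ {n} b c (B C : Subset n) → 𝟙 ((b ∷ᵥ B) ⊆? (c ∷ᵥ C)) ≡ 𝟙 (b Bool.≤? c) * 𝟙 (B ⊆? C)
𝟙-∷-⊆ outside c       B C = sym (*-identityˡ _)
𝟙-∷-⊆ inside  outside B C = refl
𝟙-∷-⊆ inside  inside  B C = sym (*-identityˡ _)

⊆∧≢⇒⊂ : ∀ {n} {p q : Subset n} → p ⊆ q → p ≢ q → p ⊂ q
⊆∧≢⇒⊂ {p = []ᵥ}          {[]ᵥ}          _   p≢q = contradiction refl p≢q
⊆∧≢⇒⊂ {p = outside ∷ᵥ p} {inside  ∷ᵥ q} p⊆q _   = out⊂in (drop-∷-⊆ p⊆q)
⊆∧≢⇒⊂ {p = inside  ∷ᵥ p} {outside ∷ᵥ q} p⊆q _   = contradiction (p⊆q here) λ ()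
⊆∧≢⇒⊂ {p = outside ∷ᵥ p} {outside ∷ᵥ q} p⊆q p≢q = s⊂s (⊆∧≢⇒⊂ (drop-∷-⊆ p⊆q) (p≢q ∘ cong (_ ∷ᵥ_)))
⊆∧≢⇒⊂ {p = inside  ∷ᵥ p} {inside  ∷ᵥ q} p⊆q p≢q = s⊂s (⊆∧≢⇒⊂ (drop-∷-⊆ p⊆q) (p≢q ∘ cong (_ ∷ᵥ_)))

𝟙-⊆-split : ∀ {n} (T U : Subset n) → 𝟙 (T ⊆? U) ≡ 𝟙 (T ≟ˢ U) + 𝟙 (T ⊂? U)
𝟙-⊆-split T U with T ≟ˢ U
... | yes refl = trans (𝟙-yes (T ⊆? T) ⊆-refl) (cong (_+_ 1ℤ) (sym (𝟙-no (T ⊂? T) (⊂-irref refl))))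
... | no  T≢U  = trans (𝟙-cong (T ⊆? U) (T ⊂? U) (mk⇔ (λ (T⊆U : T ⊆ U) → ⊆∧≢⇒⊂ T⊆U T≢U) p⊂q⇒p⊆q))
                         (sym (+-identityˡ (𝟙 (T ⊂? U))))

Δ-⊆-recursion : ∀ {n} (F : Subset n → ℤ → ℤ) U →
                (∀ x → F U (ℤ.suc x) ≡ ∑[ T ∈ subsets n ] (𝟙 (T ⊆? U) * F T x)) →
                ∀ x → Δ (F U) x ≡ ∑[ T ∈ subsets n ] (𝟙 (T ⊂? U) * F T x)
Δ-⊆-recursion {n} F U recU x = begin
  F U (ℤ.suc x) - F U x
    ≡⟨ cong (_- F U x) (recU x) ⟩
  ∑[ T ∈ subsets n ] (𝟙 (T ⊆? U) * F T x) - F U x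
    ≡⟨ cong (_- F U x) (∑-cong (subsets n) (λ T →
         trans (cong (_* F T x) (𝟙-⊆-split T U)) (*-distribʳ-+ (F T x) (𝟙 (T ≟ˢ U)) (𝟙 (T ⊂? U))))) ⟩
  ∑[ T ∈ subsets n ] (𝟙 (T ≟ˢ U) * F T x + 𝟙 (T ⊂? U) * F T x) - F U x
    ≡⟨ cong (_- F U x) (∑-distrib-+ (subsets n) (λ T → 𝟙 (T ≟ˢ U) * F T x) (λ T → 𝟙 (T ⊂? U) * F T x)) ⟩
  ∑[ T ∈ subsets n ] (𝟙 (T ≟ˢ U) * F T x) + S - F U x
    ≡⟨ cong (λ y → y + S - F U x) (sift (subsets-sifting n) U (λ T → F T x)) ⟩
  F U x + S - F U x
    ≡⟨ cancel (F U x) S ⟩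
  S ∎
  where
  open ≡-Reasoning
  S = ∑[ T ∈ subsets n ] (𝟙 (T ⊂? U) * F T x)
  cancel : ∀ a b → a + b - a ≡ b
  cancel = solve-∀

subset-recursion⇒Poly< : ∀ {n} (F : Subset n → ℤ → ℤ) →
  (∀ U → (∀ x → F U x ≡ 0ℤ) ⊎ (∀ x → F U (ℤ.suc x) ≡ ∑[ T ∈ subsets n ] (𝟙 (T ⊆? U) * F T x))) →
  ∀ U → Poly< (suc ∣ U ∣) (F U)
subset-recursion⇒Poly< {n} F rec U = bounded (suc ∣ U ∣) U ℕ.≤-refl
  where
  bounded : ∀ k U → ∣ U ∣ ℕ.< k → Poly< k (F U)
  bounded (suc k) U ∣U∣<k with rec U
  ... | inj₁ FU≗0 = Poly<-zero (suc k) FU≗0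
  ... | inj₂ recU = difference (Poly<-cong (λ x → sym (Δ-⊆-recursion F U recU x))
                                           (Poly<-∑ k (subsets n) (λ T x → 𝟙 (T ⊂? U) * F T x) smaller))
    where
    smaller : ∀ T → Poly< k (λ x → 𝟙 (T ⊂? U) * F T x)
    smaller T with T ⊂? U
    ... | yes T⊂U = Poly<-*ˡ 1ℤ (bounded k T (ℕ.<-≤-trans (p⊂q⇒∣p∣<∣q∣ T⊂U) (ℕ.≤-pred ∣U∣<k)))
    ... | no  _   = Poly<-zero k (λ x → *-zeroˡ (F T x))

∑-fibres : ∀ {a n} {X : Set a} (σ : X → Subset n) xs (ψ : Subset n → ℤ) (φ : X → ℤ) →
           ∑[ T ∈ subsets n ] (ψ T * ∑[ x ∈ xs ] (𝟙 (σ x ≟ˢ T) * φ x)) ≡ ∑[ x ∈ xs ] (ψ (σ x) * φ x)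
∑-fibres {n = n} σ xs ψ φ = begin
  ∑[ T ∈ subsets n ] (ψ T * ∑[ x ∈ xs ] (𝟙 (σ x ≟ˢ T) * φ x))
    ≡⟨ ∑-cong (subsets n) (λ T → sym (∑-*ˡ xs (ψ T) (λ x → 𝟙 (σ x ≟ˢ T) * φ x))) ⟩
  ∑[ T ∈ subsets n ] ∑[ x ∈ xs ] (ψ T * (𝟙 (σ x ≟ˢ T) * φ x))
    ≡⟨ ∑-comm (subsets n) xs (λ T x → ψ T * (𝟙 (σ x ≟ˢ T) * φ x)) ⟩
  ∑[ x ∈ xs ] ∑[ T ∈ subsets n ] (ψ T * (𝟙 (σ x ≟ˢ T) * φ x))
    ≡⟨ ∑-cong xs (λ x → trans (∑-cong (subsets n) (flip x)) (sift (subsets-sifting n) (σ x) (λ T → ψ T * φ x))) ⟩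
  ∑[ x ∈ xs ] (ψ (σ x) * φ x) ∎
  where
  open ≡-Reasoning
  flip : ∀ x T → ψ T * (𝟙 (σ x ≟ˢ T) * φ x) ≡ 𝟙 (T ≟ˢ σ x) * (ψ T * φ x)
  flip x T = trans (swap (ψ T) (𝟙 (σ x ≟ˢ T)) (φ x))
                   (cong (_* (ψ T * φ x)) (𝟙-cong (σ x ≟ˢ T) (T ≟ˢ σ x) (mk⇔ sym sym)))
    where
    swap : ∀ a b c → a * (b * c) ≡ b * (a * c)
    swap = solve-∀

x∈p─q⇒x∉q : ∀ {n} {x : Fin n} (p q : Subset n) → x ∈ p ─ q → x ∉ q
x∈p─q⇒x∉q (inside ∷ᵥ p) (outside ∷ᵥ q) here           ()
x∈p─q⇒x∉q (_      ∷ᵥ p) (_       ∷ᵥ q) (there x∈p─q) (there x∈q) = x∈p─q⇒x∉q p q x∈p─q x∈q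

p─p≡∅ : ∀ {n} (p : Subset n) → p ─ p ≡ ∅
p─p≡∅ p = Empty-unique (λ (x , x∈p─p) → x∈p─q⇒x∉q p p x∈p─p (p─q⊆p p p x∈p─p))

⊆∧─≡∅⇒≡ : ∀ {n} {S U : Subset n} → S ⊆ U → U ─ S ≡ ∅ → S ≡ U
⊆∧─≡∅⇒≡ {S = S} {U} S⊆U U─S≡∅ = ⊆-antisym S⊆U U⊆S
  where
  U⊆S : U ⊆ S
  U⊆S {x} x∈U with x ∈? S
  ... | yes x∈S = x∈S
  ... | no  x∉S = contradiction (subst (x ∈_) U─S≡∅ (x∈p∧x∉q⇒x∈p─q x∈U x∉S)) ∉⊥

disjoint-∪≡⇔ : ∀ {n} (B S U : Subset n) → (B ⊆ ∁ S × B ∪ S ≡ U) ⇔ (B ≡ U ─ S × S ⊆ U)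
disjoint-∪≡⇔ B S U = mk⇔ forward backward
  where
  forward : B ⊆ ∁ S × B ∪ S ≡ U → B ≡ U ─ S × S ⊆ U
  forward (B⊆∁S , refl) = ⊆-antisym B⊆U─S U─S⊆B , q⊆p∪q B S
    where
    B⊆U─S : B ⊆ (B ∪ S) ─ S
    B⊆U─S x∈B = x∈p∧x∉q⇒x∈p─q (p⊆p∪q S x∈B) (x∈∁p⇒x∉p (B⊆∁S x∈B))
    U─S⊆B : (B ∪ S) ─ S ⊆ B
    U─S⊆B x∈U─S with x∈p∪q⁻ B S (p─q⊆p (B ∪ S) S x∈U─S)
    ... | inj₁ x∈B = x∈B
    ... | inj₂ x∈S = contradiction x∈S (x∈p─q⇒x∉q (B ∪ S) S x∈U─S)
  backward : B ≡ U ─ S × S ⊆ U → B ⊆ ∁ S × B ∪ S ≡ U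
  backward (refl , S⊆U) = (λ x∈B → x∉p⇒x∈∁p (x∈p─q⇒x∉q U S x∈B)) , ⊆-antisym ∪⊆U U⊆∪
    where
    ∪⊆U : (U ─ S) ∪ S ⊆ U
    ∪⊆U x∈∪ with x∈p∪q⁻ (U ─ S) S x∈∪
    ... | inj₁ x∈U─S = p─q⊆p U S x∈U─S
    ... | inj₂ x∈S   = S⊆U x∈S
    U⊆∪ : U ⊆ (U ─ S) ∪ S
    U⊆∪ {x} x∈U with x ∈? S
    ... | yes x∈S = x∈p∪q⁺ (inj₂ x∈S)
    ... | no  x∉S = x∈p∪q⁺ (inj₁ (x∈p∧x∉q⇒x∈p─q x∈U x∉S))

∣∪∣-disjoint : ∀ {n} (B S : Subset n) → B ⊆ ∁ S → ∣ B ∪ S ∣ ≡ ∣ B ∣ ℕ.+ ∣ S ∣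
∣∪∣-disjoint []ᵥ             []ᵥ             _     = refl
∣∪∣-disjoint (inside  ∷ᵥ B) (inside  ∷ᵥ S) B⊆∁S = contradiction (B⊆∁S here) λ ()
∣∪∣-disjoint (inside  ∷ᵥ B) (outside ∷ᵥ S) B⊆∁S = cong suc (∣∪∣-disjoint B S (drop-∷-⊆ B⊆∁S))
∣∪∣-disjoint (outside ∷ᵥ B) (inside  ∷ᵥ S) B⊆∁S =
  trans (cong suc (∣∪∣-disjoint B S (drop-∷-⊆ B⊆∁S))) (sym (ℕ.+-suc ∣ B ∣ ∣ S ∣))
∣∪∣-disjoint (outside ∷ᵥ B) (outside ∷ᵥ S) B⊆∁S = ∣∪∣-disjoint B S (drop-∷-⊆ B⊆∁S)

sgn-∪ : ∀ {n} (B S : Subset n) → B ⊆ ∁ S → sgn (B ∪ S) ≡ sgn B * sgn S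
sgn-∪ B S B⊆∁S = trans (cong (-1ℤ ^_) (∣∪∣-disjoint B S B⊆∁S)) (^-distribˡ-+-* -1ℤ ∣ B ∣ ∣ S ∣)

∈⇔lookup : ∀ {n} (i : Fin n) (p : Subset n) → i ∈ p ⇔ lookup p i ≡ inside
∈⇔lookup i p = mk⇔ Vec.[]=⇒lookup (Vec.lookup⇒[]= i p)

subsetOf : ∀ {n p} {P : Fin n → Set p} → Decidable P → Subset n
subsetOf P? = Vec.tabulate (does ∘ P?)

∈subsetOf⇔ : ∀ {n p} {P : Fin n → Set p} (P? : Decidable P) {i} → i ∈ subsetOf P? ⇔ P i
∈subsetOf⇔ {P = P} P? {i} = mk⇔ forward backward
  where
  at : lookup (subsetOf P?) i ≡ does (P? i)
  at = Vec.lookup∘tabulate (does ∘ P?) i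
  forward : i ∈ subsetOf P? → P i
  forward i∈ with P? i | trans (sym at) (Vec.[]=⇒lookup i∈)
  ... | yes Pi | _ = Pi
  backward : P i → i ∈ subsetOf P?
  backward Pi = Vec.lookup⇒[]= i (subsetOf P?) (trans at (dec-true (P? i) Pi))

-- Colourings with a blank colour

-- A colouring f : Vec (Fin (suc q)) n uses 0 as a blank; supp f is the set of vertices it colours with 1..q.
nonblank : ∀ {q} → Fin (suc q) → Bool
nonblank zero    = outside
nonblank (suc _) = inside

supp : ∀ {n q} → Vec (Fin (suc q)) n → Subset n
supp = Vec.map nonblank

_≺_ : ∀ {q} → Fin (suc q) → Fin (suc q) → Set
zero  ≺ _     = Unit.⊤
suc _ ≺ zero  = ⊥
suc x ≺ suc y = x < y

_≺?_ : ∀ {q} (x y : Fin (suc q)) → Dec (x ≺ y)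
zero  ≺? _     = yes tt
suc _ ≺? zero  = no λ ()
suc x ≺? suc y = x Fin.<? y

-- addLayer B g puts the new colour 1 on B, where g is blank, and shifts the colours of g up by one.
layer : ∀ {q} → Bool → Fin (suc q) → Fin (suc (suc q))
layer inside  _       = suc zero
layer outside zero    = zero
layer outside (suc c) = suc (suc c)

addLayer : ∀ {n q} → Subset n → Vec (Fin (suc q)) n → Vec (Fin (suc (suc q))) n
addLayer = Vec.zipWith layer

supp-addLayer : ∀ {n q} (B : Subset n) (g : Vec (Fin (suc q)) n) → supp (addLayer B g) ≡ B ∪ supp g
supp-addLayer []ᵥ             []ᵥ            = refl
supp-addLayer (inside  ∷ᵥ B) (y ∷ᵥ g)        = cong (inside ∷ᵥ_) (supp-addLayer B g)
supp-addLayer (outside ∷ᵥ B) (zero ∷ᵥ g)     = cong (outside ∷ᵥ_) (supp-addLayer B g)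
supp-addLayer (outside ∷ᵥ B) (suc y ∷ᵥ g)    = cong (inside ∷ᵥ_) (supp-addLayer B g)

∑-layer : ∀ q (ψ : Fin (suc (suc q)) → ℤ) →
          ∑ (allFin (suc (suc q))) ψ ≡
          ∑[ y ∈ allFin (suc q) ] ∑[ b ∈ sides ] (𝟙 (b Bool.≤? not (nonblank y)) * ψ (layer b y))
∑-layer q ψ = begin
  ∑ (allFin (suc (suc q))) ψ
    ≡⟨ ∑-allFin-suc (suc q) ψ ⟩
  ψ zero + ∑[ i ∈ allFin (suc q) ] ψ (suc i)
    ≡⟨ cong (_+_ (ψ zero)) (∑-allFin-suc q (λ i → ψ (suc i))) ⟩
  ψ zero + (ψ (suc zero) + S)
    ≡⟨ regroup (ψ zero) (ψ (suc zero)) S ⟩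
  (1ℤ * ψ (suc zero) + (1ℤ * ψ zero + 0ℤ)) + S
    ≡⟨ cong (_+_ (1ℤ * ψ (suc zero) + (1ℤ * ψ zero + 0ℤ)))
         (∑-cong (allFin q) (λ i → sym (only-second (ψ (suc zero)) (ψ (suc (suc i)))))) ⟩
  (1ℤ * ψ (suc zero) + (1ℤ * ψ zero + 0ℤ)) + ∑[ i ∈ allFin q ] (0ℤ * ψ (suc zero) + (1ℤ * ψ (suc (suc i)) + 0ℤ))
    ≡⟨ sym (∑-allFin-suc q (λ y → ∑[ b ∈ sides ] (𝟙 (b Bool.≤? not (nonblank y)) * ψ (layer b y)))) ⟩
  ∑[ y ∈ allFin (suc q) ] ∑[ b ∈ sides ] (𝟙 (b Bool.≤? not (nonblank y)) * ψ (layer b y)) ∎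
  where
  open ≡-Reasoning
  S = ∑[ i ∈ allFin q ] ψ (suc (suc i))
  regroup : ∀ a b c → a + (b + c) ≡ (1ℤ * b + (1ℤ * a + 0ℤ)) + c
  regroup = solve-∀
  only-second : ∀ a b → 0ℤ * a + (1ℤ * b + 0ℤ) ≡ b
  only-second = solve-∀

∑-addLayer-∷ : ∀ {n q} (B : Subset n) (g : Vec (Fin (suc q)) n) (φ : Vec (Fin (suc (suc q))) (suc n) → ℤ) →
  𝟙 (B ⊆? ∁ (supp g)) * ∑[ x ∈ allFin (suc (suc q)) ] φ (x ∷ᵥ addLayer B g) ≡
  ∑[ y ∈ allFin (suc q) ] ∑[ b ∈ sides ] (𝟙 ((b ∷ᵥ B) ⊆? ∁ (supp (y ∷ᵥ g))) * φ (addLayer (b ∷ᵥ B) (y ∷ᵥ g)))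
∑-addLayer-∷ {q = q} B g φ = begin
  c * ∑[ x ∈ allFin (suc (suc q)) ] φ (x ∷ᵥ addLayer B g)
    ≡⟨ cong (c *_) (∑-layer q (λ x → φ (x ∷ᵥ addLayer B g))) ⟩
  c * ∑[ y ∈ allFin (suc q) ] ∑[ b ∈ sides ] ψ y b
    ≡⟨ sym (∑-*ˡ (allFin (suc q)) c (λ y → ∑[ b ∈ sides ] ψ y b)) ⟩
  ∑[ y ∈ allFin (suc q) ] (c * ∑[ b ∈ sides ] ψ y b)
    ≡⟨ ∑-cong (allFin (suc q)) (λ y → sym (∑-*ˡ sides c (ψ y))) ⟩
  ∑[ y ∈ allFin (suc q) ] ∑[ b ∈ sides ] (c * ψ y b)
    ≡⟨ ∑-cong (allFin (suc q)) (λ y → ∑-cong sides (λ b → merge-indicators y b)) ⟩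
  ∑[ y ∈ allFin (suc q) ] ∑[ b ∈ sides ] (𝟙 ((b ∷ᵥ B) ⊆? ∁ (supp (y ∷ᵥ g))) * φ (addLayer (b ∷ᵥ B) (y ∷ᵥ g))) ∎
  where
  open ≡-Reasoning
  c = 𝟙 (B ⊆? ∁ (supp g))
  ψ : Fin (suc q) → Bool → ℤ
  ψ y b = 𝟙 (b Bool.≤? not (nonblank y)) * φ (layer b y ∷ᵥ addLayer B g)
  merge-indicators : ∀ y b → c * ψ y b ≡ 𝟙 ((b ∷ᵥ B) ⊆? ∁ (supp (y ∷ᵥ g))) * φ (addLayer (b ∷ᵥ B) (y ∷ᵥ g))
  merge-indicators y b = trans (swap c e _) (cong (_* φ (layer b y ∷ᵥ addLayer B g))
                                                  (sym (𝟙-∷-⊆ b (not (nonblank y)) B (∁ (supp g)))))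
    where
    e = 𝟙 (b Bool.≤? not (nonblank y))
    swap : ∀ c e x → c * (e * x) ≡ e * c * x
    swap = solve-∀

∑-addLayer : ∀ n q (φ : Vec (Fin (suc (suc q))) n → ℤ) →
  ∑ (vectors (allFin (suc (suc q))) n) φ ≡
  ∑[ g ∈ vectors (allFin (suc q)) n ] ∑[ B ∈ subsets n ] (𝟙 (B ⊆? ∁ (supp g)) * φ (addLayer B g))
∑-addLayer zero    q φ = cong (_+ 0ℤ) (sym (trans (+-identityʳ (1ℤ * φ []ᵥ)) (*-identityˡ (φ []ᵥ))))
∑-addLayer (suc n) q φ = begin
  ∑ (vectors F₂ (suc n)) φ
    ≡⟨ ∑-vectors-suc F₂ n φ ⟩
  ∑[ v ∈ vectors F₂ n ] ∑[ x ∈ F₂ ] φ (x ∷ᵥ v)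
    ≡⟨ ∑-addLayer n q (λ v → ∑[ x ∈ F₂ ] φ (x ∷ᵥ v)) ⟩
  ∑[ g ∈ vectors F₁ n ] ∑[ B ∈ subsets n ] (𝟙 (B ⊆? ∁ (supp g)) * ∑[ x ∈ F₂ ] φ (x ∷ᵥ addLayer B g))
    ≡⟨ ∑-cong (vectors F₁ n) (λ g → ∑-cong (subsets n) (λ B → ∑-addLayer-∷ B g φ)) ⟩
  ∑[ g ∈ vectors F₁ n ] ∑[ B ∈ subsets n ] ∑[ y ∈ F₁ ] ∑[ b ∈ sides ] term (y ∷ᵥ g) (b ∷ᵥ B)
    ≡⟨ ∑-cong (vectors F₁ n) (λ g → ∑-comm (subsets n) F₁ (λ B y → ∑[ b ∈ sides ] term (y ∷ᵥ g) (b ∷ᵥ B))) ⟩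
  ∑[ g ∈ vectors F₁ n ] ∑[ y ∈ F₁ ] ∑[ B ∈ subsets n ] ∑[ b ∈ sides ] term (y ∷ᵥ g) (b ∷ᵥ B)
    ≡⟨ ∑-cong (vectors F₁ n) (λ g → ∑-cong F₁ (λ y → sym (∑-vectors-suc sides n (term (y ∷ᵥ g))))) ⟩
  ∑[ g ∈ vectors F₁ n ] ∑[ y ∈ F₁ ] ∑[ B ∈ subsets (suc n) ] term (y ∷ᵥ g) B
    ≡⟨ sym (∑-vectors-suc F₁ n (λ g → ∑[ B ∈ subsets (suc n) ] term g B)) ⟩
  ∑[ g ∈ vectors F₁ (suc n) ] ∑[ B ∈ subsets (suc n) ] term g B ∎
  where
  open ≡-Reasoning
  F₁ = allFin (suc q)
  F₂ = allFin (suc (suc q))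
  term : Vec (Fin (suc q)) (suc n) → Subset (suc n) → ℤ
  term g B = 𝟙 (B ⊆? ∁ (supp g)) * φ (addLayer B g)

layer-≤⁺ : ∀ {q} b c (x y : Fin (suc q)) → (b ≡ inside → x ≡ zero) → (c ≡ inside → y ≡ zero) →
           x ≤ y → (b ≡ inside → c ∨ nonblank y ≡ inside) → layer b x ≤ layer c y
layer-≤⁺ inside  inside  _       _       _ _  _  _    = s≤s z≤n
layer-≤⁺ inside  outside _       zero    _ _  _  side = contradiction (side refl) λ ()
layer-≤⁺ inside  outside _       (suc y) _ _  _  _    = s≤s z≤n
layer-≤⁺ outside c       zero    y       _ _  _  _    = z≤n
layer-≤⁺ outside inside  (suc x) zero    _ _  () _
layer-≤⁺ outside inside  (suc x) (suc y) _ cy _  _    = contradiction (cy refl) λ ()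
layer-≤⁺ outside outside (suc x) zero    _ _  () _
layer-≤⁺ outside outside (suc x) (suc y) _ _  le _    = s≤s le

layer-≤⁻ : ∀ {q} b c (x y : Fin (suc q)) → (b ≡ inside → x ≡ zero) →
           layer b x ≤ layer c y → x ≤ y × (b ≡ inside → c ∨ nonblank y ≡ inside)
layer-≤⁻ inside  inside  zero    y       _  _        = z≤n , λ _ → refl
layer-≤⁻ inside  outside zero    zero    _  ()
layer-≤⁻ inside  outside zero    (suc y) _  _        = z≤n , λ _ → refl
layer-≤⁻ inside  c       (suc x) y       bx _        = contradiction (bx refl) λ ()
layer-≤⁻ outside c       zero    y       _  _        = z≤n , λ ()
layer-≤⁻ outside inside  (suc x) y       _  (s≤s ())
layer-≤⁻ outside outside (suc x) zero    _  ()
layer-≤⁻ outside outside (suc x) (suc y) _  le       = ℕ.≤-pred le , λ ()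

layer-≺⁺ : ∀ {q} b c (x y : Fin (suc q)) → (c ≡ inside → y ≡ zero) →
           x ≺ y → (b ≡ inside → nonblank y ≡ inside) → layer b x ≺ layer c y
layer-≺⁺ inside  c       _       zero    _  _  side = contradiction (side refl) λ ()
layer-≺⁺ inside  inside  _       (suc y) cy _  _    = contradiction (cy refl) λ ()
layer-≺⁺ inside  outside _       (suc y) _  _  _    = s≤s z≤n
layer-≺⁺ outside c       zero    y       _  _  _    = tt
layer-≺⁺ outside c       (suc x) zero    _  () _
layer-≺⁺ outside inside  (suc x) (suc y) cy _  _    = contradiction (cy refl) λ ()
layer-≺⁺ outside outside (suc x) (suc y) _  lt _    = s≤s lt

layer-≺⁻ : ∀ {q} b c (x y : Fin (suc q)) → (b ≡ inside → x ≡ zero) →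
           layer b x ≺ layer c y → x ≺ y × (b ≡ inside → nonblank y ≡ inside)
layer-≺⁻ inside  inside  zero    y       _  ()
layer-≺⁻ inside  outside zero    zero    _  ()
layer-≺⁻ inside  outside zero    (suc y) _  _        = tt , λ _ → refl
layer-≺⁻ inside  c       (suc x) y       bx _        = contradiction (bx refl) λ ()
layer-≺⁻ outside c       zero    y       _  _        = tt , λ ()
layer-≺⁻ outside inside  (suc x) y       _  ()
layer-≺⁻ outside outside (suc x) zero    _  ()
layer-≺⁻ outside outside (suc x) (suc y) _  lt       = ℕ.≤-pred lt , λ ()

∑-full-support : ∀ n q (φ : Vec (Fin (suc q)) n → ℤ) →
                 ∑[ f ∈ vectors (allFin (suc q)) n ] (𝟙 (supp f ≟ˢ ⊤) * φ f) ≡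
                 ∑[ g ∈ vectors (allFin q) n ] φ (Vec.map suc g)
∑-full-support zero    q φ = cong (_+ 0ℤ) (*-identityˡ (φ []ᵥ))
∑-full-support (suc n) q φ = begin
  ∑[ f ∈ vectors F₁ (suc n) ] (𝟙 (supp f ≟ˢ ⊤) * φ f)
    ≡⟨ ∑-vectors-suc F₁ n (λ f → 𝟙 (supp f ≟ˢ ⊤) * φ f) ⟩
  ∑[ v ∈ vectors F₁ n ] ∑[ x ∈ F₁ ] (𝟙 (supp (x ∷ᵥ v) ≟ˢ ⊤) * φ (x ∷ᵥ v))
    ≡⟨ ∑-cong (vectors F₁ n) (λ v → trans (∑-allFin-suc q (λ x → 𝟙 (supp (x ∷ᵥ v) ≟ˢ ⊤) * φ (x ∷ᵥ v)))
                                         (+-identityˡ (∑[ y ∈ F₀ ] (𝟙 (supp v ≟ˢ ⊤) * φ (suc y ∷ᵥ v))))) ⟩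
  ∑[ v ∈ vectors F₁ n ] ∑[ y ∈ F₀ ] (𝟙 (supp v ≟ˢ ⊤) * φ (suc y ∷ᵥ v))
    ≡⟨ ∑-comm (vectors F₁ n) F₀ (λ v y → 𝟙 (supp v ≟ˢ ⊤) * φ (suc y ∷ᵥ v)) ⟩
  ∑[ y ∈ F₀ ] ∑[ v ∈ vectors F₁ n ] (𝟙 (supp v ≟ˢ ⊤) * φ (suc y ∷ᵥ v))
    ≡⟨ ∑-cong F₀ (λ y → ∑-full-support n q (λ v → φ (suc y ∷ᵥ v))) ⟩
  ∑[ y ∈ F₀ ] ∑[ w ∈ vectors F₀ n ] φ (suc y ∷ᵥ Vec.map suc w)
    ≡⟨ ∑-comm F₀ (vectors F₀ n) (λ y w → φ (suc y ∷ᵥ Vec.map suc w)) ⟩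
  ∑[ w ∈ vectors F₀ n ] ∑[ y ∈ F₀ ] φ (suc y ∷ᵥ Vec.map suc w)
    ≡⟨ sym (∑-vectors-suc F₀ n (λ g → φ (Vec.map suc g))) ⟩
  ∑[ g ∈ vectors F₀ (suc n) ] φ (Vec.map suc g) ∎
  where
  open ≡-Reasoning
  F₀ = allFin q
  F₁ = allFin (suc q)

module _ {n q : ℕ} (i : Fin n) where

  lookup-supp : (g : Vec (Fin (suc q)) n) → lookup (supp g) i ≡ nonblank (lookup g i)
  lookup-supp g = Vec.lookup-map i nonblank g

  lookup-addLayer : (B : Subset n) (g : Vec (Fin (suc q)) n) → lookup (addLayer B g) i ≡ layer (lookup B i) (lookup g i)
  lookup-addLayer B g = Vec.lookup-zipWith layer i B g

  ∈supp⇔ : (g : Vec (Fin (suc q)) n) → i ∈ supp g ⇔ nonblank (lookup g i) ≡ inside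
  ∈supp⇔ g = mk⇔ (λ i∈ → trans (sym (lookup-supp g)) (to (∈⇔lookup i (supp g)) i∈))
                 (λ eq → from (∈⇔lookup i (supp g)) (trans (lookup-supp g) eq))

  ∈∪supp⇔ : (B : Subset n) (g : Vec (Fin (suc q)) n) → i ∈ B ∪ supp g ⇔ (lookup B i ∨ nonblank (lookup g i)) ≡ inside
  ∈∪supp⇔ B g = mk⇔ (λ i∈ → trans (sym lookup-∪) (to (∈⇔lookup i (B ∪ supp g)) i∈))
                    (λ eq → from (∈⇔lookup i (B ∪ supp g)) (trans lookup-∪ eq))
    where
    lookup-∪ : lookup (B ∪ supp g) i ≡ (lookup B i ∨ nonblank (lookup g i))
    lookup-∪ = trans (Vec.lookup-zipWith _∨_ i B (supp g)) (cong (lookup B i ∨_) (lookup-supp g))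

  blank-outside-supp : {B : Subset n} (g : Vec (Fin (suc q)) n) → B ⊆ ∁ (supp g) → lookup B i ≡ inside → lookup g i ≡ zero
  blank-outside-supp {B} g B⊆∁supp Bi =
    blank (lookup g i) (trans (sym lookup-∁) (to (∈⇔lookup i (∁ (supp g))) (B⊆∁supp (from (∈⇔lookup i B) Bi))))
    where
    lookup-∁ : lookup (∁ (supp g)) i ≡ not (nonblank (lookup g i))
    lookup-∁ = trans (Vec.lookup-map i not (supp g)) (cong not (lookup-supp g))
    blank : ∀ x → not (nonblank x) ≡ inside → x ≡ zero
    blank zero _ = refl

module Colourings {n : ℕ} (A : List (Fin n × Fin n)) where

  BlankStrictOK : ∀ {q} → Vec (Fin (suc q)) n → Set
  BlankStrictOK f = All (λ { (u , v) → lookup f u ≺ lookup f v }) A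

  weak? : ∀ {q} (f : Vec (Fin q) n) → Dec (WeakOK A f)
  weak? f = all? (λ { (u , v) → lookup f u Fin.≤? lookup f v }) A

  strict? : ∀ {q} (f : Vec (Fin (suc q)) n) → Dec (BlankStrictOK f)
  strict? f = all? (λ { (u , v) → lookup f u ≺? lookup f v }) A

  module _ {q : ℕ} (g : Vec (Fin q) n) where

    private
      at : ∀ i → lookup (Vec.map Fin.suc g) i ≡ Fin.suc (lookup g i)
      at i = Vec.lookup-map i Fin.suc g

    weak-map-suc : WeakOK A (Vec.map Fin.suc g) ⇔ WeakOK A g
    weak-map-suc = mk⇔
      (All.map λ {(u , v)} le → ℕ.≤-pred (subst₂ _≤_ (at u) (at v) le))
      (All.map λ {(u , v)} le → subst₂ _≤_ (sym (at u)) (sym (at v)) (s≤s le))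

    strict-map-suc : BlankStrictOK (Vec.map Fin.suc g) ⇔ StrictOK A g
    strict-map-suc = mk⇔
      (All.map λ {(u , v)} lt → subst₂ _≺_ (at u) (at v) lt)
      (All.map λ {(u , v)} lt → subst₂ _≺_ (sym (at u)) (sym (at v)) lt)

  module _ {q : ℕ} {B : Subset n} {g : Vec (Fin (suc q)) n} (B⊆∁supp : B ⊆ ∁ (supp g)) where

    private
      compat : ∀ i → lookup B i ≡ inside → lookup g i ≡ zero
      compat i = blank-outside-supp i g B⊆∁supp
      at : ∀ i → lookup (addLayer B g) i ≡ layer (lookup B i) (lookup g i)
      at i = lookup-addLayer i B g

    addLayer-weak : WeakOK A (addLayer B g) ⇔ (WeakOK A g × All (λ { (u , v) → u ∈ B → v ∈ B ∪ supp g }) A)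
    addLayer-weak = All-⇔× arc A
      where
      arc : ∀ ((u , v) : Fin n × Fin n) → (lookup (addLayer B g) u ≤ lookup (addLayer B g) v) ⇔
                                             (lookup g u ≤ lookup g v × (u ∈ B → v ∈ B ∪ supp g))
      arc (u , v) = mk⇔
        (λ le → let (le′ , side) = layer-≤⁻ (lookup B u) (lookup B v) (lookup g u) (lookup g v) (compat u)
                                     (subst₂ _≤_ (at u) (at v) le)
                in le′ , λ u∈B → from (∈∪supp⇔ v B g) (side (to (∈⇔lookup u B) u∈B)))
        (λ (le , side) → subst₂ _≤_ (sym (at u)) (sym (at v))
           (layer-≤⁺ (lookup B u) (lookup B v) (lookup g u) (lookup g v) (compat u) (compat v) le
              (λ Bu → to (∈∪supp⇔ v B g) (side (from (∈⇔lookup u B) Bu)))))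

    addLayer-strict : BlankStrictOK (addLayer B g) ⇔ (BlankStrictOK g × All (λ { (u , v) → u ∈ B → v ∈ supp g }) A)
    addLayer-strict = All-⇔× arc A
      where
      arc : ∀ ((u , v) : Fin n × Fin n) → (lookup (addLayer B g) u ≺ lookup (addLayer B g) v) ⇔
                                             (lookup g u ≺ lookup g v × (u ∈ B → v ∈ supp g))
      arc (u , v) = mk⇔
        (λ lt → let (lt′ , side) = layer-≺⁻ (lookup B u) (lookup B v) (lookup g u) (lookup g v) (compat u)
                                     (subst₂ _≺_ (at u) (at v) lt)
                in lt′ , λ u∈B → from (∈supp⇔ v g) (side (to (∈⇔lookup u B) u∈B)))
        (λ (lt , side) → subst₂ _≺_ (sym (at u)) (sym (at v))
           (layer-≺⁺ (lookup B u) (lookup B v) (lookup g u) (lookup g v) (compat v) lt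
              (λ Bu → to (∈supp⇔ v g) (side (from (∈⇔lookup u B) Bu)))))

  UpClosed : Subset n → Set
  UpClosed U = All (λ { (u , v) → u ∈ U → v ∈ U }) A

  upClosed? : ∀ U → Dec (UpClosed U)
  upClosed? U = all? (λ { (u , v) → u ∈? U →-dec v ∈? U }) A

  weak⇒upClosed : ∀ {q} (f : Vec (Fin (suc q)) n) → WeakOK A f → UpClosed (supp f)
  weak⇒upClosed f = All.map λ {(u , v)} le u∈ →
    from (∈supp⇔ v f) (monotone (lookup f u) (lookup f v) le (to (∈supp⇔ u f) u∈))
    where
    monotone : ∀ {q} (x y : Fin (suc q)) → x ≤ y → nonblank x ≡ inside → nonblank y ≡ inside
    monotone (suc x) (suc y) _ _ = refl

  strict⇒upClosed : ∀ {q} (f : Vec (Fin (suc q)) n) → BlankStrictOK f → UpClosed (supp f)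
  strict⇒upClosed f = All.map λ {(u , v)} lt u∈ →
    from (∈supp⇔ v f) (monotone (lookup f u) (lookup f v) lt (to (∈supp⇔ u f) u∈))
    where
    monotone : ∀ {q} (x y : Fin (suc q)) → x ≺ y → nonblank x ≡ inside → nonblank y ≡ inside
    monotone (suc x) (suc y) _ _ = refl

  IsSinkOf : Subset n → Fin n → Set
  IsSinkOf T v = v ∈ T × ¬ Any (λ { (u , w) → u ≡ v × w ∈ T }) A

  sink? : ∀ T v → Dec (IsSinkOf T v)
  sink? T v = v ∈? T ×-dec ¬? (any? (λ { (u , w) → u Fin.≟ v ×-dec w ∈? T }) A)

  sinks : Subset n → Subset n
  sinks T = subsetOf (sink? T)

  HasSinks : Set
  HasSinks = ∀ {T v} → v ∈ T → ∃ (_∈ sinks T)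

  sinks⊆ : ∀ T → sinks T ⊆ T
  sinks⊆ T v∈ = proj₁ (to (∈subsetOf⇔ (sink? T)) v∈)

  sinks-─≡∅⇔≡ : HasSinks → ∀ {S U} → S ⊆ U → sinks (U ─ S) ≡ ∅ ⇔ S ≡ U
  sinks-─≡∅⇔≡ hasSinks {S} {U} S⊆U = mk⇔
    (λ no-sinks → ⊆∧─≡∅⇒≡ S⊆U (Empty-unique (λ (v , v∈) →
       let (w , w∈sinks) = hasSinks v∈ in ∉⊥ (subst (w ∈_) no-sinks w∈sinks))))
    (λ { refl → Empty-unique (λ (v , v∈) → ∉⊥ (subst (v ∈_) (p─p≡∅ U) (sinks⊆ (U ─ U) v∈))) })

  module _ {q : ℕ} {U : Subset n} (up : UpClosed U) (B : Subset n) (g : Vec (Fin (suc q)) n) where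

    private
      S = supp g

    weak-addLayer⇔ : (B ⊆ ∁ S × supp (addLayer B g) ≡ U × WeakOK A (addLayer B g)) ⇔ (B ≡ U ─ S × S ⊆ U × WeakOK A g)
    weak-addLayer⇔ = mk⇔
      (λ (B⊆∁S , M≡U , wk) →
        let (B≡U─S , S⊆U) = to (disjoint-∪≡⇔ B S U) (B⊆∁S , trans (sym (supp-addLayer B g)) M≡U)
        in B≡U─S , S⊆U , proj₁ (to (addLayer-weak B⊆∁S) wk))
      (λ (B≡U─S , S⊆U , wk) →
        let (B⊆∁S , B∪S≡U) = from (disjoint-∪≡⇔ B S U) (B≡U─S , S⊆U)
            B⊆U : B ⊆ U
            B⊆U x∈B = subst (_ ∈_) B∪S≡U (p⊆p∪q S x∈B)
        in B⊆∁S , trans (supp-addLayer B g) B∪S≡U ,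
           from (addLayer-weak B⊆∁S) (wk , All.map (λ closed u∈B → subst (_ ∈_) (sym B∪S≡U) (closed (B⊆U u∈B))) up))

    strict-addLayer⇒ : B ⊆ ∁ S × supp (addLayer B g) ⊆ U × BlankStrictOK (addLayer B g) →
                       B ⊆ sinks (U ─ S) × S ⊆ U × BlankStrictOK g
    strict-addLayer⇒ (B⊆∁S , M⊆U , st) = B⊆sinks , (λ x∈S → B∪S⊆U (q⊆p∪q B S x∈S)) , proj₁ strict-and-out
      where
      B∪S⊆U : B ∪ S ⊆ U
      B∪S⊆U x∈ = M⊆U (subst (_ ∈_) (sym (supp-addLayer B g)) x∈)
      strict-and-out = to (addLayer-strict B⊆∁S) st
      B⊆sinks : B ⊆ sinks (U ─ S)
      B⊆sinks {x} x∈B = from (∈subsetOf⇔ (sink? (U ─ S)))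
        (x∈p∧x∉q⇒x∈p─q (B∪S⊆U (p⊆p∪q S x∈B)) (x∈∁p⇒x∉p (B⊆∁S x∈B)) , no-arc)
        where
        no-arc : ¬ Any (λ { (u , w) → u ≡ x × w ∈ U ─ S }) A
        no-arc arc with find arc
        ... | _ , a∈A , refl , w∈U─S = x∈p─q⇒x∉q U S w∈U─S (All.lookup (proj₂ strict-and-out) a∈A x∈B)

    strict-addLayer⇐ : B ⊆ sinks (U ─ S) × S ⊆ U × BlankStrictOK g →
                       B ⊆ ∁ S × supp (addLayer B g) ⊆ U × BlankStrictOK (addLayer B g)
    strict-addLayer⇐ (B⊆sinks , S⊆U , st) =
      B⊆∁S , M⊆U , from (addLayer-strict B⊆∁S) (st , All.tabulate (λ { {u , w} → into-supp }))
      where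
      B⊆U─S : B ⊆ U ─ S
      B⊆U─S x∈B = sinks⊆ (U ─ S) (B⊆sinks x∈B)
      B⊆∁S : B ⊆ ∁ S
      B⊆∁S x∈B = x∉p⇒x∈∁p (x∈p─q⇒x∉q U S (B⊆U─S x∈B))
      M⊆U : supp (addLayer B g) ⊆ U
      M⊆U x∈M with x∈p∪q⁻ B S (subst (_ ∈_) (supp-addLayer B g) x∈M)
      ... | inj₁ x∈B = p─q⊆p U S (B⊆U─S x∈B)
      ... | inj₂ x∈S = S⊆U x∈S
      into-supp : ∀ {u w} → (u , w) ∈ₗ A → u ∈ B → w ∈ S
      into-supp {u} {w} a∈A u∈B with w ∈? S
      ... | yes w∈S = w∈S
      ... | no  w∉S = contradiction (lose a∈A (refl , x∈p∧x∉q⇒x∈p─q w∈U w∉S))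
                                    (proj₂ (to (∈subsetOf⇔ (sink? (U ─ S))) (B⊆sinks u∈B)))
        where
        w∈U : w ∈ U
        w∈U = All.lookup up a∈A (p─q⊆p U S (B⊆U─S u∈B))

  -- The colourings of D[U] with colours 1..q, encoded by colour 0 on the vertices outside U.
  weakCountOn strictCountOn : Subset n → ℕ → ℤ
  weakCountOn   U q = ∑[ f ∈ vectors (allFin (suc q)) n ] (𝟙 (supp f ≟ˢ U) * 𝟙 (weak? f))
  strictCountOn U q = ∑[ f ∈ vectors (allFin (suc q)) n ] (𝟙 (supp f ≟ˢ U) * 𝟙 (strict? f))

  weakCountOn-suc : ∀ {U} → UpClosed U → ∀ q →
                    weakCountOn U (suc q) ≡ ∑[ T ∈ subsets n ] (𝟙 (T ⊆? U) * weakCountOn T q)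
  weakCountOn-suc {U} up q = begin
    weakCountOn U (suc q)
      ≡⟨ ∑-addLayer n q (λ f → 𝟙 (supp f ≟ˢ U) * 𝟙 (weak? f)) ⟩
    ∑[ g ∈ colourings ] ∑[ B ∈ subsets n ] (𝟙 (B ⊆? ∁ (supp g)) * (𝟙 (supp (addLayer B g) ≟ˢ U) * 𝟙 (weak? (addLayer B g))))
      ≡⟨ ∑-cong colourings (λ g → ∑-cong (subsets n) (λ B → layer-condition B g)) ⟩
    ∑[ g ∈ colourings ] ∑[ B ∈ subsets n ] (𝟙 (B ≟ˢ (U ─ supp g)) * (𝟙 (supp g ⊆? U) * 𝟙 (weak? g)))
      ≡⟨ ∑-cong colourings (λ g → sift (subsets-sifting n) (U ─ supp g) (λ _ → 𝟙 (supp g ⊆? U) * 𝟙 (weak? g))) ⟩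
    ∑[ g ∈ colourings ] (𝟙 (supp g ⊆? U) * 𝟙 (weak? g))
      ≡⟨ sym (∑-fibres supp colourings (λ T → 𝟙 (T ⊆? U)) (λ g → 𝟙 (weak? g))) ⟩
    ∑[ T ∈ subsets n ] (𝟙 (T ⊆? U) * weakCountOn T q) ∎
    where
    open ≡-Reasoning
    colourings = vectors (allFin (suc q)) n
    layer-condition : ∀ B g → 𝟙 (B ⊆? ∁ (supp g)) * (𝟙 (supp (addLayer B g) ≟ˢ U) * 𝟙 (weak? (addLayer B g)))
                            ≡ 𝟙 (B ≟ˢ (U ─ supp g)) * (𝟙 (supp g ⊆? U) * 𝟙 (weak? g))
    layer-condition B g = begin
      𝟙 c * (𝟙 e * 𝟙 w)        ≡⟨ 𝟙-×³ c e w ⟩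
      𝟙 (c ×-dec e ×-dec w)    ≡⟨ 𝟙-cong (c ×-dec e ×-dec w) (c′ ×-dec e′ ×-dec w′) (weak-addLayer⇔ up B g) ⟩
      𝟙 (c′ ×-dec e′ ×-dec w′) ≡⟨ sym (𝟙-×³ c′ e′ w′) ⟩
      𝟙 c′ * (𝟙 e′ * 𝟙 w′)     ∎
      where
      c = B ⊆? ∁ (supp g)
      e = supp (addLayer B g) ≟ˢ U
      w = weak? (addLayer B g)
      c′ = B ≟ˢ (U ─ supp g)
      e′ = supp g ⊆? U
      w′ = weak? g

  strictTerm : Subset n → ∀ {q} → Vec (Fin (suc q)) n → ℤ
  strictTerm U f = 𝟙 (supp f ⊆? U) * sgn (supp f) * 𝟙 (strict? f)

  strictTerm-addLayer : ∀ {U} → UpClosed U → ∀ {q} B (g : Vec (Fin (suc q)) n) →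
    𝟙 (B ⊆? ∁ (supp g)) * strictTerm U (addLayer B g) ≡ 𝟙 (B ⊆? sinks (U ─ supp g)) * sgn B * strictTerm U g
  strictTerm-addLayer {U} up B g = begin
    𝟙 c * (𝟙 m * sgn M * 𝟙 st)                ≡⟨ rearrange (𝟙 c) (𝟙 m) (sgn M) (𝟙 st) ⟩
    𝟙 c * (𝟙 m * 𝟙 st) * sgn M                ≡⟨ cong (_* sgn M) (𝟙-×³ c m st) ⟩
    𝟙 (c ×-dec m ×-dec st) * sgn M            ≡⟨ 𝟙-*-cong (c ×-dec m ×-dec st) (k ×-dec s ×-dec st′)
                                                    (mk⇔ (strict-addLayer⇒ up B g) (strict-addLayer⇐ up B g))
                                                    (λ (B⊆∁S , _) → trans (cong sgn (supp-addLayer B g)) (sgn-∪ B S B⊆∁S)) ⟩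
    𝟙 (k ×-dec s ×-dec st′) * (sgn B * sgn S) ≡⟨ cong (_* (sgn B * sgn S)) (sym (𝟙-×³ k s st′)) ⟩
    𝟙 k * (𝟙 s * 𝟙 st′) * (sgn B * sgn S)     ≡⟨ regroup (𝟙 k) (𝟙 s) (𝟙 st′) (sgn B) (sgn S) ⟩
    𝟙 k * sgn B * strictTerm U g              ∎
    where
    open ≡-Reasoning
    S = supp g
    M = supp (addLayer B g)
    c = B ⊆? ∁ S
    m = M ⊆? U
    st = strict? (addLayer B g)
    k = B ⊆? sinks (U ─ S)
    s = S ⊆? U
    st′ = strict? g
    rearrange : ∀ c m x t → c * (m * x * t) ≡ c * (m * t) * x
    rearrange = solve-∀
    regroup : ∀ k s t b z → k * (s * t) * (b * z) ≡ k * b * (s * z * t)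
    regroup = solve-∀

  strictTerm-no-sinks : HasSinks → ∀ {U q} (g : Vec (Fin (suc q)) n) →
    𝟙 (sinks (U ─ supp g) ≟ˢ ∅) * strictTerm U g ≡ sgn U * (𝟙 (supp g ≟ˢ U) * 𝟙 (strict? g))
  strictTerm-no-sinks hasSinks {U} g = begin
    𝟙 z * (𝟙 s * sgn S * 𝟙 st)       ≡⟨ rearrange (𝟙 z) (𝟙 s) (sgn S) (𝟙 st) ⟩
    𝟙 z * (𝟙 s * 𝟙 st) * sgn S       ≡⟨ cong (_* sgn S) (𝟙-×³ z s st) ⟩
    𝟙 (z ×-dec s ×-dec st) * sgn S   ≡⟨ 𝟙-*-cong (z ×-dec s ×-dec st) (e ×-dec st) equivalence
                                           (cong sgn ∘ proj₁ ∘ to equivalence) ⟩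
    𝟙 (e ×-dec st) * sgn U           ≡⟨ cong (_* sgn U) (𝟙-× e st) ⟩
    𝟙 e * 𝟙 st * sgn U               ≡⟨ *-comm (𝟙 e * 𝟙 st) (sgn U) ⟩
    sgn U * (𝟙 e * 𝟙 st)             ∎
    where
    open ≡-Reasoning
    S = supp g
    z = sinks (U ─ S) ≟ˢ ∅
    s = S ⊆? U
    st = strict? g
    e = S ≟ˢ U
    rearrange : ∀ z s x t → z * (s * x * t) ≡ z * (s * t) * x
    rearrange = solve-∀
    equivalence : (sinks (U ─ S) ≡ ∅ × S ⊆ U × BlankStrictOK g) ⇔ (S ≡ U × BlankStrictOK g)
    equivalence = mk⇔
      (λ (no-sinks , S⊆U , st) → to (sinks-─≡∅⇔≡ hasSinks S⊆U) no-sinks , st)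
      (λ (S≡U , st) → let S⊆U = subst (S ⊆_) S≡U ⊆-refl in from (sinks-─≡∅⇔≡ hasSinks S⊆U) S≡U , S⊆U , st)

  -- Inclusion–exclusion over the colour-1 layer, which consists of sinks; only an empty layer survives.
  strictCountOn-pred : HasSinks → ∀ {U} → UpClosed U → ∀ q →
                       ∑[ T ∈ subsets n ] (𝟙 (T ⊆? U) * (sgn T * strictCountOn T (suc q))) ≡ sgn U * strictCountOn U q
  strictCountOn-pred hasSinks {U} up q = begin
    ∑[ T ∈ subsets n ] (𝟙 (T ⊆? U) * (sgn T * strictCountOn T (suc q)))
      ≡⟨ ∑-cong (subsets n) (λ T → sym (*-assoc (𝟙 (T ⊆? U)) (sgn T) (strictCountOn T (suc q)))) ⟩
    ∑[ T ∈ subsets n ] (𝟙 (T ⊆? U) * sgn T * strictCountOn T (suc q))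
      ≡⟨ ∑-fibres supp (vectors (allFin (suc (suc q))) n) (λ T → 𝟙 (T ⊆? U) * sgn T) (λ f → 𝟙 (strict? f)) ⟩
    ∑[ f ∈ vectors (allFin (suc (suc q))) n ] strictTerm U f
      ≡⟨ ∑-addLayer n q (strictTerm U) ⟩
    ∑[ g ∈ colourings ] ∑[ B ∈ subsets n ] (𝟙 (B ⊆? ∁ (supp g)) * strictTerm U (addLayer B g))
      ≡⟨ ∑-cong colourings (λ g → ∑-cong (subsets n) (λ B → strictTerm-addLayer up B g)) ⟩
    ∑[ g ∈ colourings ] ∑[ B ∈ subsets n ] (𝟙 (B ⊆? sinks (U ─ supp g)) * sgn B * strictTerm U g)
      ≡⟨ ∑-cong colourings (λ g → ∑-*ʳ (subsets n) (strictTerm U g) (λ B → 𝟙 (B ⊆? sinks (U ─ supp g)) * sgn B)) ⟩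
    ∑[ g ∈ colourings ] (∑[ B ∈ subsets n ] (𝟙 (B ⊆? sinks (U ─ supp g)) * sgn B) * strictTerm U g)
      ≡⟨ ∑-cong colourings (λ g → cong (_* strictTerm U g) (∑-sgn-⊆ (sinks (U ─ supp g)))) ⟩
    ∑[ g ∈ colourings ] (𝟙 (sinks (U ─ supp g) ≟ˢ ∅) * strictTerm U g)
      ≡⟨ ∑-cong colourings (strictTerm-no-sinks hasSinks) ⟩
    ∑[ g ∈ colourings ] (sgn U * (𝟙 (supp g ≟ˢ U) * 𝟙 (strict? g)))
      ≡⟨ ∑-*ˡ colourings (sgn U) (λ g → 𝟙 (supp g ≟ˢ U) * 𝟙 (strict? g)) ⟩
    sgn U * strictCountOn U q ∎
    where
    open ≡-Reasoning
    colourings = vectors (allFin (suc q)) n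

  weakCountOn-¬upClosed : ∀ {U} → ¬ UpClosed U → ∀ q → weakCountOn U q ≡ 0ℤ
  weakCountOn-¬upClosed {U} ¬up q = ∑-zero (vectors (allFin (suc q)) n) λ f →
    trans (sym (𝟙-× (supp f ≟ˢ U) (weak? f)))
          (𝟙-no (supp f ≟ˢ U ×-dec weak? f) (λ (supp≡U , wk) → ¬up (subst UpClosed supp≡U (weak⇒upClosed f wk))))

  strictCountOn-¬upClosed : ∀ {U} → ¬ UpClosed U → ∀ q → strictCountOn U q ≡ 0ℤ
  strictCountOn-¬upClosed {U} ¬up q = ∑-zero (vectors (allFin (suc q)) n) λ f →
    trans (sym (𝟙-× (supp f ≟ˢ U) (strict? f)))
          (𝟙-no (supp f ≟ˢ U ×-dec strict? f) (λ (supp≡U , st) → ¬up (subst UpClosed supp≡U (strict⇒upClosed f st))))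

  -- With a single colour only the blank colouring exists.
  weakCountOn-zero : ∀ U → weakCountOn U 0 ≡ sgn U * strictCountOn U 0
  weakCountOn-zero U = begin
    weakCountOn U 0                                    ≡⟨ ∑-vectors-singleton zero n _ ⟩
    𝟙 e * 𝟙 (weak? blank)                              ≡⟨ cong (𝟙 e *_) (𝟙-yes (weak? blank) blank-weak) ⟩
    𝟙 e * 1ℤ                                           ≡⟨ signed e ⟩
    sgn U * (𝟙 e * 1ℤ)                                 ≡⟨ cong (λ x → sgn U * (𝟙 e * x))
                                                            (sym (𝟙-yes (strict? blank) blank-strict)) ⟩
    sgn U * (𝟙 e * 𝟙 (strict? blank))                  ≡⟨ cong (sgn U *_) (sym (∑-vectors-singleton zero n _)) ⟩
    sgn U * strictCountOn U 0                          ∎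
    where
    open ≡-Reasoning
    blank : Vec (Fin 1) n
    blank = Vec.replicate n zero
    e = supp blank ≟ˢ U
    blank-weak : WeakOK A blank
    blank-weak = All.tabulate λ {(u , v)} _ → subst (_≤ lookup blank v) (sym (Vec.lookup-replicate u zero)) z≤n
    blank-strict : BlankStrictOK blank
    blank-strict = All.tabulate λ {(u , v)} _ → subst (_≺ lookup blank v) (sym (Vec.lookup-replicate u zero)) tt
    signed : (d : Dec (supp blank ≡ U)) → 𝟙 d * 1ℤ ≡ sgn U * (𝟙 d * 1ℤ)
    signed (yes refl) =
      sym (trans (*-identityʳ _) (cong (-1ℤ ^_) (trans (cong ∣_∣ (Vec.map-replicate nonblank zero n)) (∣⊥∣≡0 n))))
    signed (no _)     = sym (*-zeroʳ (sgn U))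

  weakChromatic : Subset n → ℤ → ℤ
  weakChromatic U (+ q)    = weakCountOn U q
  weakChromatic U -[1+ q ] = sgn U * strictCountOn U (suc q)

  weakChromatic-Poly< : HasSinks → ∀ U → Poly< (suc ∣ U ∣) (weakChromatic U)
  weakChromatic-Poly< hasSinks = subset-recursion⇒Poly< weakChromatic recursion
    where
    recursion : ∀ U → (∀ x → weakChromatic U x ≡ 0ℤ) ⊎
                      (∀ x → weakChromatic U (ℤ.suc x) ≡ ∑[ T ∈ subsets n ] (𝟙 (T ⊆? U) * weakChromatic T x))
    recursion U with upClosed? U
    ... | no ¬up = inj₁ λ { (+ q)    → weakCountOn-¬upClosed ¬up q
                          ; -[1+ q ] → trans (cong (sgn U *_) (strictCountOn-¬upClosed ¬up (suc q))) (*-zeroʳ (sgn U)) }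
    ... | yes up = inj₂ λ { (+ q)        → weakCountOn-suc up q
                          ; -[1+ zero ]  → trans (weakCountOn-zero U) (sym (strictCountOn-pred hasSinks up 0))
                          ; -[1+ suc q ] → sym (strictCountOn-pred hasSinks up (suc q)) }

-- Reciprocity for acyclic digraphs

module _ (D : Digraph) where
  open Colourings (arcs D)

  Acyclic : Set
  Acyclic = ∀ {a} → a ∈ₗ arcs D → ¬ Cyclic D a

  -- Following arcs inside a sink-free T from v forever must revisit a vertex, closing a cycle.
  acyclic⇒sinks : Acyclic → HasSinks
  acyclic⇒sinks acyclic {T} {v} v∈T with Fin.any? (λ w → w ∈? sinks T)
  ... | yes sink    = sink
  ... | no  no-sink = contradiction (Fin.pigeonhole (ℕ.n<1+n (nV D)) (λ k → vertex (toℕ k))) no-repetition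
    where
    step : ∀ {w} → w ∈ T → ∃ λ w′ → (w , w′) ∈ₗ arcs D × w′ ∈ T
    step {w} w∈T with find (decidable-stable (any? (λ { (u , w′) → u Fin.≟ w ×-dec w′ ∈? T }) (arcs D))
                            (λ no-arc → no-sink (w , from (∈subsetOf⇔ (sink? T)) (w∈T , no-arc))))
    ... | _ , a∈ , refl , w′∈T = _ , a∈ , w′∈T
    walk : ℕ → ∃ (_∈ T)
    walk zero    = v , v∈T
    walk (suc k) = let (w′ , _ , w′∈T) = step (proj₂ (walk k)) in w′ , w′∈T
    vertex : ℕ → Fin (nV D)
    vertex k = proj₁ (walk k)
    arc : ∀ k → (vertex k , vertex (suc k)) ∈ₗ arcs D
    arc k = proj₁ (proj₂ (step (proj₂ (walk k))))
    walk-reach : ∀ {i j} → i ℕ.≤ j → Reach D (vertex i) (vertex j)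
    walk-reach {i} {zero}  z≤n = ε
    walk-reach {i} {suc j} i≤1+j with ℕ.m≤n⇒m<n∨m≡n i≤1+j
    ... | inj₁ i<1+j = walk-reach (ℕ.≤-pred i<1+j) ◅◅ (arc j ◅ ε)
    ... | inj₂ refl  = ε
    no-repetition : ¬ ∃₂ λ i j → i Fin.< j × vertex (toℕ i) ≡ vertex (toℕ j)
    no-repetition (i , j , i<j , same) =
      acyclic (arc (toℕ i)) (subst (Reach D (vertex (suc (toℕ i)))) (sym same) (walk-reach i<j))

  weakCountOn-⊤ : ∀ q → weakCountOn ⊤ q ≡ + weakCount D q
  weakCountOn-⊤ q = begin
    weakCountOn ⊤ q
      ≡⟨ ∑-full-support (nV D) q (λ f → 𝟙 (weak? f)) ⟩
    ∑[ g ∈ vectors (allFin q) (nV D) ] 𝟙 (weak? (Vec.map Fin.suc g))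
      ≡⟨ ∑-cong (vectors (allFin q) (nV D)) (λ g → 𝟙-cong (weak? (Vec.map Fin.suc g)) (weak? g) (weak-map-suc g)) ⟩
    ∑[ g ∈ vectors (allFin q) (nV D) ] 𝟙 (weak? g)
      ≡⟨ cong (λ fs → ∑[ g ∈ fs ] 𝟙 (weak? g)) (sym (allMaps≡vectors (nV D) q)) ⟩
    ∑[ g ∈ allMaps (nV D) q ] 𝟙 (weak? g)
      ≡⟨ sym (length-filter weak? (allMaps (nV D) q)) ⟩
    + weakCount D q ∎
    where open ≡-Reasoning

  strictCountOn-⊤ : ∀ q → strictCountOn ⊤ q ≡ + strictCount D q
  strictCountOn-⊤ q = begin
    strictCountOn ⊤ q
      ≡⟨ ∑-full-support (nV D) q (λ f → 𝟙 (strict? f)) ⟩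
    ∑[ g ∈ vectors (allFin q) (nV D) ] 𝟙 (strict? (Vec.map Fin.suc g))
      ≡⟨ ∑-cong (vectors (allFin q) (nV D)) (λ g → 𝟙-cong (strict? (Vec.map Fin.suc g)) (strictOK? g) (strict-map-suc g)) ⟩
    ∑[ g ∈ vectors (allFin q) (nV D) ] 𝟙 (strictOK? g)
      ≡⟨ cong (λ fs → ∑[ g ∈ fs ] 𝟙 (strictOK? g)) (sym (allMaps≡vectors (nV D) q)) ⟩
    ∑[ g ∈ allMaps (nV D) q ] 𝟙 (strictOK? g)
      ≡⟨ sym (length-filter strictOK? (allMaps (nV D) q)) ⟩
    + strictCount D q ∎
    where
    open ≡-Reasoning
    strictOK? : ∀ {q} (g : Vec (Fin q) (nV D)) → Dec (StrictOK (arcs D) g)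
    strictOK? g = All.all? (λ { (u , v) → lookup g u Fin.<? lookup g v }) (arcs D)

  weak-strict-reciprocity : Acyclic → (P : Poly) → IsWeakChromPoly D P →
                            ∀ q → eval P -[1+ q ] ≡ -1ℤ ^ nV D * + strictCount D (suc q)
  weak-strict-reciprocity acyclic P weak-poly q = begin
    eval P -[1+ q ]
      ≡⟨ Poly<-agree (Poly<-eval P) (weakChromatic-Poly< (acyclic⇒sinks acyclic) ⊤) agree -[1+ q ] ⟩
    weakChromatic ⊤ -[1+ q ]
      ≡⟨ cong₂ _*_ (cong (-1ℤ ^_) (∣⊤∣≡n (nV D))) (strictCountOn-⊤ (suc q)) ⟩
    -1ℤ ^ nV D * + strictCount D (suc q) ∎
    where
    open ≡-Reasoning
    agree : ∀ k → eval P (+ suc k) ≡ weakChromatic ⊤ (+ suc k)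
    agree k = trans (weak-poly k) (sym (weakCountOn-⊤ (suc k)))

-- Contracting the cyclic arcs

contracted-arc : ∀ {n m} {cyc : Fin n × Fin n → Set} {c : Fin n → Fin m} {as bs} → ContractArcs cyc c as bs →
                 ∀ {x y} → (x , y) ∈ₗ bs → ∃₂ λ u v → (u , v) ∈ₗ as × ¬ cyc (u , v) × c u ≡ x × c v ≡ y
contracted-arc (drop _ arcs)      x,y∈ with contracted-arc arcs x,y∈
... | u , v , u,v∈ , ¬cyc , cu , cv = u , v , Any.there u,v∈ , ¬cyc , cu , cv
contracted-arc (keep ¬cyc arcs) (Any.here refl) = _ , _ , Any.here refl , ¬cyc , refl , refl
contracted-arc (keep _ arcs)    (Any.there x,y∈) with contracted-arc arcs x,y∈
... | u , v , u,v∈ , ¬cyc , cu , cv = u , v , Any.there u,v∈ , ¬cyc , cu , cv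

module Contraction {D D′ : Digraph} (acyc : IsAcyc D D′) where
  open IsAcyc acyc

  identified⇒reach : ∀ {u v} → c u ≡ c v → Reach D u v
  identified⇒reach {u} {v} cu≡cv = closure⇒reach (to (c-ident u v) cu≡cv)
    where
    closure⇒reach : ∀ {u v} → EqClosure (CycArc D) u v → Reach D u v
    closure⇒reach ε                         = ε
    closure⇒reach (fwd (u,v∈ , _)   ◅ rest) = u,v∈ ◅ closure⇒reach rest
    closure⇒reach (bwd (_ , u↝v)    ◅ rest) = u↝v ◅◅ closure⇒reach rest

  reach-lift : ∀ {x y} → Reach D′ x y → ∀ {u v} → c u ≡ x → c v ≡ y → Reach D u v
  reach-lift ε             cu≡x cv≡x = identified⇒reach (trans cu≡x (sym cv≡x))
  reach-lift (x,z∈ ◅ z↝y) cu≡x cv≡y with contracted-arc c-arcs x,z∈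
  ... | u′ , w , u′,w∈ , _ , cu′≡x , cw≡z =
    identified⇒reach (trans cu≡x (sym cu′≡x)) ◅◅ u′,w∈ ◅ reach-lift z↝y cw≡z cv≡y

  acyc-acyclic : Acyclic D′
  acyc-acyclic {x , y} x,y∈ y↝x with contracted-arc c-arcs x,y∈
  ... | u , v , _ , ¬cyc , cu≡x , cv≡y = ¬cyc (reach-lift y↝x cv≡y cu≡x)

  weak-monotone : ∀ {q} (f : Vec (Fin q) (nV D)) → WeakOK (arcs D) f → ∀ {u v} → Reach D u v → lookup f u ≤ lookup f v
  weak-monotone f wk ε             = Fin.≤-refl
  weak-monotone f wk (u,w∈ ◅ w↝v) = Fin.≤-trans (All.lookup wk u,w∈) (weak-monotone f wk w↝v)

  weak-identified : ∀ {q} (f : Vec (Fin q) (nV D)) → WeakOK (arcs D) f → ∀ {u v} → c u ≡ c v → lookup f u ≡ lookup f v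
  weak-identified f wk cu≡cv = Fin.≤-antisym (weak-monotone f wk (identified⇒reach cu≡cv))
                                             (weak-monotone f wk (identified⇒reach (sym cu≡cv)))

  private
    section : Fin (nV D′) → Fin (nV D)
    section j = proj₁ (c-surj j)

  lift : ∀ {q} → Vec (Fin q) (nV D′) → Vec (Fin q) (nV D)
  lift g = tabulate (lookup g ∘ c)

  descend : ∀ {q} → Vec (Fin q) (nV D) → Vec (Fin q) (nV D′)
  descend f = tabulate (lookup f ∘ section)

  private
    lookup-lift : ∀ {q} (g : Vec (Fin q) (nV D′)) i → lookup (lift g) i ≡ lookup g (c i)
    lookup-lift g = Vec.lookup∘tabulate (lookup g ∘ c)

    lookup-descend : ∀ {q} (f : Vec (Fin q) (nV D)) j → lookup (descend f) j ≡ lookup f (section j)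
    lookup-descend f = Vec.lookup∘tabulate (lookup f ∘ section)

  lift-weak : ∀ {q} (g : Vec (Fin q) (nV D′)) → WeakOK (arcs D′) g → WeakOK (arcs D) (lift g)
  lift-weak g = go c-arcs (λ a∈ → a∈)
    where
    go : ∀ {as bs} → ContractArcs (Cyclic D) c as bs → (∀ {a} → a ∈ₗ as → a ∈ₗ arcs D) →
         All (λ { (x , y) → lookup g x ≤ lookup g y }) bs → All (λ { (u , v) → lookup (lift g) u ≤ lookup (lift g) v }) as
    go done                   _   []         = []
    go (drop {u , v} cyc arcs) ⊆D wk         =
      Fin.≤-reflexive (trans (lookup-lift g u) (trans (cong (lookup g) cu≡cv) (sym (lookup-lift g v))))
        ∷ go arcs (⊆D ∘ Any.there) wk
      where
      cu≡cv : c u ≡ c v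
      cu≡cv = from (c-ident u v) (fwd (⊆D (Any.here refl) , cyc) ◅ ε)
    go (keep {u} {v} _ arcs) ⊆D (le ∷ wk) =
      subst₂ _≤_ (sym (lookup-lift g u)) (sym (lookup-lift g v)) le ∷ go arcs (⊆D ∘ Any.there) wk

  lift-injective : ∀ {q} {g g′ : Vec (Fin q) (nV D′)} → lift g ≡ lift g′ → g ≡ g′
  lift-injective {g = g} {g′} lg≡lg′ = ≗⇒≡ λ j → begin
    lookup g j                  ≡⟨ cong (lookup g) (sym (proj₂ (c-surj j))) ⟩
    lookup g (c (section j))    ≡⟨ sym (lookup-lift g (section j)) ⟩
    lookup (lift g) (section j) ≡⟨ cong (λ f → lookup f (section j)) lg≡lg′ ⟩
    lookup (lift g′) (section j) ≡⟨ lookup-lift g′ (section j) ⟩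
    lookup g′ (c (section j))   ≡⟨ cong (lookup g′) (proj₂ (c-surj j)) ⟩
    lookup g′ j                 ∎
    where open ≡-Reasoning

  descend-weak : ∀ {q} (f : Vec (Fin q) (nV D)) → WeakOK (arcs D) f → WeakOK (arcs D′) (descend f) × lift (descend f) ≡ f
  descend-weak f wk = All.tabulate arc , ≗⇒≡ lifted
    where
    constant : ∀ {u} j → c u ≡ j → lookup (descend f) j ≡ lookup f u
    constant {u} j cu≡j = trans (lookup-descend f j) (weak-identified f wk (trans (proj₂ (c-surj j)) (sym cu≡j)))
    arc : ∀ {(x , y) : Fin (nV D′) × Fin (nV D′)} → (x , y) ∈ₗ arcs D′ → lookup (descend f) x ≤ lookup (descend f) y
    arc x,y∈ with contracted-arc c-arcs x,y∈
    ... | u , v , u,v∈ , _ , cu≡x , cv≡y =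
      subst₂ _≤_ (sym (constant _ cu≡x)) (sym (constant _ cv≡y)) (All.lookup wk u,v∈)
    lifted : ∀ i → lookup (lift (descend f)) i ≡ lookup f i
    lifted i = trans (lookup-lift (descend f) i) (constant (c i) refl)

  weakCount-acyc : ∀ q → + weakCount D q ≡ + weakCount D′ q
  weakCount-acyc q = begin
    + weakCount D q
      ≡⟨ length-filter weak? (allMaps (nV D) q) ⟩
    ∑[ f ∈ allMaps (nV D) q ] 𝟙 (weak? f)
      ≡⟨ cong (λ fs → ∑[ f ∈ fs ] 𝟙 (weak? f)) (allMaps≡vectors (nV D) q) ⟩
    ∑[ f ∈ vectors (allFin q) (nV D) ] 𝟙 (weak? f)
      ≡⟨ ∑-𝟙-transport (vectors (allFin q) (nV D)) (vectors (allFin q) (nV D′))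
           (vectors-sifting (allFin-sifting q) (nV D)) (vectors-sifting (allFin-sifting q) (nV D′)) weak? weak′? lift
           (λ _ _ → lift-injective) (λ {g} → lift-weak g) (λ {f} wk → descend f , descend-weak f wk) ⟩
    ∑[ g ∈ vectors (allFin q) (nV D′) ] 𝟙 (weak′? g)
      ≡⟨ cong (λ gs → ∑[ g ∈ gs ] 𝟙 (weak′? g)) (sym (allMaps≡vectors (nV D′) q)) ⟩
    ∑[ g ∈ allMaps (nV D′) q ] 𝟙 (weak′? g)
      ≡⟨ sym (length-filter weak′? (allMaps (nV D′) q)) ⟩
    + weakCount D′ q ∎
    where
    open ≡-Reasoning
    open Colourings (arcs D) using (weak?)
    open Colourings (arcs D′) using () renaming (weak? to weak′?)

lemma6p5 : (D D' : Digraph) → IsAcyc D D' → (P : Poly) → IsWeakChromPoly D P →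
           (q : ℕ) →
           eval P (- (+ suc q)) ≡ ((- (+ 1)) ^ nV D') * (+ strictCount D' (suc q))
lemma6p5 D D' acyc P weak-poly =
  weak-strict-reciprocity D' acyc-acyclic P (λ k → trans (weak-poly k) (weakCount-acyc (suc k)))
  where open Contraction acyc
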